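{- There is no skew-symmetric amorphous association scheme with $4$ classes.
   Context: Let $X$ be a finite set with $|X|\ge 2$ and $R=\{R_0,\dots,R_d\}$ a set of binary relations on $X$. $(X,R)$ is an association scheme with $d$ classes if: (i) $R$ partitions $X\times X$ and $R_0=\{(x,x):x\in X\}$; (ii) for each $i$, the inverse $R_i^{T}=\{(y,x):(x,y)\in R_i\}$ equals $R_{i'}$ for some $i'$; (iii) for all $i,j,k$ there is an integer $p^k_{ij}$ such that for every $(x,y)\in R_k$, $|\{z:(x,z)\in R_i,(z,y)\in R_j\}|=p^k_{ij}$. $R_i$ is symmetric if $R_i^T=R_i$. The scheme is skew-symmetric if $R_0$ is its only symmetric relation. A partition $\Lambda_0,\Lambda_1,\dots,\Lambda_e$ of the index set $\{0,1,\dots,d\}$ is admissible if $\Lambda_0=\{0\}$, each $\Lambda_i$ is nonempty, and for each $i$ the set $\Lambda_i^T=\{\alpha':\alpha\in\Lambda_i\}$ equals some $\Lambda_j$. Given such a partition, set $R_{\Lambda_i}=\bigcup_{\alpha\in\Lambda_i}R_\alpha$; if $(X,\{R_{\Lambda_i}\}_{i=0}^e)$ is an association scheme it is called a fusion scheme. The scheme is amorphous if every admissible partition of $\{0,\dots,d\}$ gives rise to a fusion scheme. -}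

module Defs where

open import Data.Nat using (ℕ; zero; suc; _+_; _≤_)
open import Data.Bool using (Bool; true; false; _∧_; if_then_else_)
open import Data.Fin using (Fin; zero; suc; _≟_)
open import Data.Product using (Σ; Σ-syntax; ∃; ∃-syntax; _×_; _,_; proj₁)
open import Function.Bundles using (_⇔_)
open import Relation.Nullary.Decidable using (⌊_⌋)
open import Relation.Binary.PropositionalEquality using (_≡_)

count : ∀ {n} → (Fin n → Bool) → ℕ
count {zero}  P = 0
count {suc n} P = (if P zero then 1 else 0) + count (λ z → P (suc z))

-- A family of relations R_0,…,R_d on X = Fin n that partitions X × X is
-- encoded by its class function r : (x , y) ↦ the unique i with (x,y) ∈ R_i.
-- So R_i = { (x , y) | r x y ≡ i }.
record IsAssocScheme {n d : ℕ} (r : Fin n → Fin n → Fin (suc d)) : Set where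
  field
    nonempty : ∀ (i : Fin (suc d)) → ∃[ x ] ∃[ y ] r x y ≡ i
    diagonal : ∀ (x y : Fin n) → (r x y ≡ zero) ⇔ (x ≡ y)
    transpose : ∀ (i : Fin (suc d)) →
      Σ[ i' ∈ Fin (suc d) ] (∀ (x y : Fin n) → (r y x ≡ i) ⇔ (r x y ≡ i'))
    intersection : ∀ (i j k : Fin (suc d)) → Σ[ p ∈ ℕ ]
      (∀ (x y : Fin n) → r x y ≡ k →
        count (λ z → ⌊ r x z ≟ i ⌋ ∧ ⌊ r z y ≟ j ⌋) ≡ p)

  tr : Fin (suc d) → Fin (suc d)
  tr i = proj₁ (transpose i)

SymmetricClass : ∀ {n d} → (Fin n → Fin n → Fin (suc d)) → Fin (suc d) → Set
SymmetricClass {n} r i = ∀ (x y : Fin n) → (r y x ≡ i) ⇔ (r x y ≡ i)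

SkewSymmetric : ∀ {n d} → (Fin n → Fin n → Fin (suc d)) → Set
SkewSymmetric {d = d} r = ∀ (i : Fin (suc d)) → SymmetricClass r i → i ≡ zero

-- A partition Λ_0,…,Λ_e of {0,…,d} is encoded by f : α ↦ the j with α ∈ Λ_j.
record IsAdmissible {n d e : ℕ} {r : Fin n → Fin n → Fin (suc d)}
    (S : IsAssocScheme r) (f : Fin (suc d) → Fin (suc e)) : Set where
  open IsAssocScheme S
  field
    parts-nonempty : ∀ (j : Fin (suc e)) → ∃[ α ] f α ≡ j
    part-zero : ∀ (α : Fin (suc d)) → (f α ≡ zero) ⇔ (α ≡ zero)
    part-transpose : ∀ (i : Fin (suc e)) → Σ[ j ∈ Fin (suc e) ]
      (∀ (β : Fin (suc d)) → (f β ≡ j) ⇔ (∃[ α ] (f α ≡ i × β ≡ tr α)))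

Amorphous : ∀ {n d} {r : Fin n → Fin n → Fin (suc d)} → IsAssocScheme r → Set
Amorphous {n} {d} {r} S =
  ∀ (e : ℕ) (f : Fin (suc d) → Fin (suc e)) → IsAdmissible S f →
    IsAssocScheme (λ x y → f (r x y))

module Submission where

-- Name the relations o (the diagonal), a, a' = aᵀ, b, b' = bᵀ; let k₁, k₂ be
-- the valencies of a and b, so that there are N = 1 + 2 (k₁ + k₂) points.
-- Amorphy makes every admissible fusion an association scheme, and we compute
-- with the integer matrices A, A', B, B' of the relations:
--   • the fusions {a, b} | {a', b'} and {a, b'} | {a', b} are doubly regular
--     tournaments, so k₁ + k₂ is odd and D = A − A', E = B − B' satisfy
--     D² + E² = J − N I;
--   • in the fusion {a} | {a'} | {b, b'}, A and A' commute, whence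
--     (A + A') D = θ D; symmetrically (B + B') E = q E, so (A + A') E = −(1 + q) E;
--   • (A + A')(D² + E²) and (A + A')²(D² + E²) on the diagonal give two
--     equations forcing k₂ to be even; for the swapped scheme, k₁ is even.

open import Defs
open import Data.Nat using (ℕ; _≤_)
open import Data.Fin using (Fin)
open import Relation.Nullary using (¬_; contradiction)

open import Data.Nat using (zero; suc; s≤s)
open import Data.Fin using (zero; suc; _≟_; punchIn)
open import Data.Fin.Properties using (punchInᵢ≢i; all?; any?)
open import Data.Fin.Patterns using (0F; 1F; 2F; 3F; 4F)
open import Data.Integer using (ℤ; +_; _+_; _*_; -_; _-_; 0ℤ; 1ℤ; -1ℤ; ∣_∣)
open import Data.Integer.DivMod using (_%ℕ_; _/ℕ_; n%ℕd<d; a≡a%ℕn+[a/ℕn]*n)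
import Data.Integer.Properties as ℤP
import Data.Nat.Properties as ℕP
open import Data.Integer.Tactic.RingSolver using (solve-∀)
open import Data.Bool using (Bool; true; false; _∧_)
import Data.Bool as Bool
open import Data.Bool.Properties using (∧-idem)
open import Data.Product using (∃; _×_; _,_; proj₁; proj₂; map₂)
open import Data.Sum using (_⊎_; inj₁; inj₂)
open import Data.Empty using (⊥; ⊥-elim)
open import Function using (_∘_)
open import Function.Bundles using (_⇔_; Equivalence; mk⇔)
open import Function.Properties.Equivalence using () renaming (sym to ⇔-sym)
open import Relation.Binary.Bundles using (Setoid)
import Relation.Binary.Reasoning.Setoid
open import Relation.Binary.PropositionalEquality
  using (_≡_; _≢_; refl; sym; trans; cong; cong₂; subst; module ≡-Reasoning)
open import Relation.Nullary.Decidable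
  using (Dec; yes; no; ⌊_⌋; True; toWitness; map′; _→-dec_; isYes≗does; does-⇔; dec-true; dec-false)
import Relation.Unary as U
open import Algebra.Properties.Semiring.Sum ℤP.+-*-semiring
  using (sum; sum-cong-≗; ∑-distrib-+; ∑-comm; *-distribˡ-sum; *-distribʳ-sum;
         sum-remove; sum-replicate-zero)

-- Finite sums of integers

sum-const : ∀ m (k : ℤ) → sum {m} (λ _ → k) ≡ + m * k
sum-const zero    k = refl
sum-const (suc m) k = trans (cong (_+_ k) (sum-const m k)) (step (+ m) k)
  where
  step : ∀ M k → k + M * k ≡ (1ℤ + M) * k
  step = solve-∀

sum-neg : ∀ {m} (f : Fin m → ℤ) → sum (λ z → - f z) ≡ - sum f
sum-neg f = begin
  sum (λ z → - f z)       ≡⟨ sum-cong-≗ (λ z → sym (ℤP.-1*i≡-i (f z))) ⟩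
  sum (λ z → -1ℤ * f z)   ≡⟨ sym (*-distribˡ-sum -1ℤ f) ⟩
  -1ℤ * sum f             ≡⟨ ℤP.-1*i≡-i (sum f) ⟩
  - sum f                 ∎
  where open ≡-Reasoning

sum-sub : ∀ {m} (f g : Fin m → ℤ) → sum (λ z → f z - g z) ≡ sum f - sum g
sum-sub f g = trans (∑-distrib-+ f (λ z → - g z)) (cong (_+_ (sum f)) (sum-neg g))

sum-single : ∀ {m} (f : Fin (suc m) → ℤ) (i : Fin (suc m)) →
  (∀ j → j ≢ i → f j ≡ 0ℤ) → sum f ≡ f i
sum-single {m} f i vanish = begin
  sum f                             ≡⟨ sum-remove {i = i} f ⟩
  f i + sum (λ j → f (punchIn i j)) ≡⟨ cong (_+_ (f i)) rest ⟩
  f i + 0ℤ                          ≡⟨ ℤP.+-identityʳ (f i) ⟩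
  f i                               ∎
  where
  open ≡-Reasoning
  rest : sum (λ j → f (punchIn i j)) ≡ 0ℤ
  rest = trans (sum-cong-≗ (λ j → vanish (punchIn i j) (punchInᵢ≢i i j)))
               (sum-replicate-zero m)

cancel-positive : ∀ {k X Y : ℤ} → (∃ λ j → k ≡ + suc j) → k * X ≡ k * Y → X ≡ Y
cancel-positive {X = X} {Y} (j , refl) = ℤP.*-cancelˡ-≡ (+ suc j) X Y

⌊⌋-true : ∀ {A : Set} (a? : Dec A) → A → ⌊ a? ⌋ ≡ true
⌊⌋-true a? a = trans (isYes≗does a?) (dec-true a? a)

⌊⌋-false : ∀ {A : Set} (a? : Dec A) → ¬ A → ⌊ a? ⌋ ≡ false
⌊⌋-false a? ¬a = trans (isYes≗does a?) (dec-false a? ¬a)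

⌊⌋-⇔ : ∀ {A B : Set} → A ⇔ B → (a? : Dec A) (b? : Dec B) → ⌊ a? ⌋ ≡ ⌊ b? ⌋
⌊⌋-⇔ A⇔B a? b? = trans (isYes≗does a?) (trans (does-⇔ A⇔B a? b?) (sym (isYes≗does b?)))

χ : Bool → ℤ
χ true  = 1ℤ
χ false = 0ℤ

χ-∧ : ∀ p q → χ (p ∧ q) ≡ χ p * χ q
χ-∧ true  q = sym (ℤP.*-identityˡ (χ q))
χ-∧ false q = refl

sum-δ : ∀ {m} (H : Fin (suc m) → ℤ) j → sum (λ i → H i * χ ⌊ j ≟ i ⌋) ≡ H j
sum-δ H j = begin
  sum (λ i → H i * χ ⌊ j ≟ i ⌋) ≡⟨ sum-single (λ i → H i * χ ⌊ j ≟ i ⌋) j off-diagonal ⟩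
  H j * χ ⌊ j ≟ j ⌋             ≡⟨ cong (λ t → H j * χ t) (⌊⌋-true (j ≟ j) refl) ⟩
  H j * 1ℤ                      ≡⟨ ℤP.*-identityʳ (H j) ⟩
  H j                           ∎
  where
  open ≡-Reasoning
  off-diagonal : ∀ i → i ≢ j → H i * χ ⌊ j ≟ i ⌋ ≡ 0ℤ
  off-diagonal i i≢j =
    trans (cong (λ t → H i * χ t) (⌊⌋-false (j ≟ i) (i≢j ∘ sym))) (ℤP.*-zeroʳ (H i))

count-sum : ∀ {m} (P : Fin m → Bool) → + count P ≡ sum (λ z → χ (P z))
count-sum {zero}  P = refl
count-sum {suc m} P with P zero
... | true  = cong (_+_ 1ℤ) (count-sum (λ z → P (suc z)))
... | false = cong (_+_ 0ℤ) (count-sum (λ z → P (suc z)))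

count-cong : ∀ {m} {P Q : Fin m → Bool} → (∀ z → P z ≡ Q z) → count P ≡ count Q
count-cong {P = P} {Q} eq =
  ℤP.+-injective (trans (count-sum P) (trans (sum-cong-≗ (cong χ ∘ eq)) (sym (count-sum Q))))

count-positive : ∀ {m} (P : Fin m → Bool) z → P z ≡ true → ∃ λ j → count P ≡ suc j
count-positive P zero    Pz rewrite Pz = _ , refl
count-positive P (suc z) Pz with P zero
... | true  = _ , refl
... | false = count-positive (λ z → P (suc z)) z Pz

-- Integer matrices indexed by a finite set, with entrywise equality

Mat : ℕ → Set
Mat m = Fin m → Fin m → ℤ

infixl 7 _⊗_
infixl 6 _⊕_ _⊖_
infixr 7 _⊙_
infix  4 _≐_

_⊗_ : ∀ {m} → Mat m → Mat m → Mat m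
(M ⊗ N) x y = sum (λ z → M x z * N z y)

_⊕_ _⊖_ : ∀ {m} → Mat m → Mat m → Mat m
(M ⊕ N) x y = M x y + N x y
(M ⊖ N) x y = M x y - N x y

_⊙_ : ∀ {m} → ℤ → Mat m → Mat m
(k ⊙ M) x y = k * M x y

_≐_ : ∀ {m} → Mat m → Mat m → Set
M ≐ N = ∀ x y → M x y ≡ N x y

≐-setoid : ℕ → Setoid _ _
≐-setoid m = record
  { Carrier = Mat m
  ; _≈_ = _≐_
  ; isEquivalence = record
    { refl  = λ x y → refl
    ; sym   = λ eq x y → sym (eq x y)
    ; trans = λ eq eq′ x y → trans (eq x y) (eq′ x y)
    }
  }

module ≐-Reasoning {m} = Relation.Binary.Reasoning.Setoid (≐-setoid m)

≐-sym : ∀ {m} {M N : Mat m} → M ≐ N → N ≐ M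
≐-sym eq x y = sym (eq x y)

⊕-cong : ∀ {m} {M M′ N N′ : Mat m} → M ≐ M′ → N ≐ N′ → M ⊕ N ≐ M′ ⊕ N′
⊕-cong eq eq′ x y = cong₂ _+_ (eq x y) (eq′ x y)

⊖-cong : ∀ {m} {M M′ N N′ : Mat m} → M ≐ M′ → N ≐ N′ → M ⊖ N ≐ M′ ⊖ N′
⊖-cong eq eq′ x y = cong₂ _-_ (eq x y) (eq′ x y)

⊗-congˡ : ∀ {m} {M M′ : Mat m} (N : Mat m) → M ≐ M′ → M ⊗ N ≐ M′ ⊗ N
⊗-congˡ N eq x y = sum-cong-≗ (λ z → cong (_* N z y) (eq x z))

⊗-congʳ : ∀ {m} (M : Mat m) {N N′ : Mat m} → N ≐ N′ → M ⊗ N ≐ M ⊗ N′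
⊗-congʳ M eq x y = sum-cong-≗ (λ z → cong (M x z *_) (eq z y))

⊗-assoc : ∀ {m} (M N P : Mat m) → (M ⊗ N) ⊗ P ≐ M ⊗ (N ⊗ P)
⊗-assoc M N P x y = begin
  sum (λ w → sum (λ z → M x z * N z w) * P w y)   ≡⟨ sum-cong-≗ (λ w → *-distribʳ-sum (P w y) (λ z → M x z * N z w)) ⟩
  sum (λ w → sum (λ z → M x z * N z w * P w y))   ≡⟨ ∑-comm (λ w z → M x z * N z w * P w y) ⟩
  sum (λ z → sum (λ w → M x z * N z w * P w y))   ≡⟨ sum-cong-≗ (λ z → sum-cong-≗ (λ w → ℤP.*-assoc (M x z) (N z w) (P w y))) ⟩
  sum (λ z → sum (λ w → M x z * (N z w * P w y))) ≡⟨ sum-cong-≗ (λ z → sym (*-distribˡ-sum (M x z) (λ w → N z w * P w y))) ⟩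
  sum (λ z → M x z * sum (λ w → N z w * P w y))   ∎
  where open ≡-Reasoning

⊗-distribˡ-⊕ : ∀ {m} (M N P : Mat m) → M ⊗ (N ⊕ P) ≐ M ⊗ N ⊕ M ⊗ P
⊗-distribˡ-⊕ M N P x y =
  trans (sum-cong-≗ (λ z → ℤP.*-distribˡ-+ (M x z) (N z y) (P z y)))
        (∑-distrib-+ (λ z → M x z * N z y) (λ z → M x z * P z y))

⊗-distribʳ-⊕ : ∀ {m} (M N P : Mat m) → (M ⊕ N) ⊗ P ≐ M ⊗ P ⊕ N ⊗ P
⊗-distribʳ-⊕ M N P x y =
  trans (sum-cong-≗ (λ z → ℤP.*-distribʳ-+ (P z y) (M x z) (N x z)))
        (∑-distrib-+ (λ z → M x z * P z y) (λ z → N x z * P z y))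

⊗-distribˡ-⊖ : ∀ {m} (M N P : Mat m) → M ⊗ (N ⊖ P) ≐ M ⊗ N ⊖ M ⊗ P
⊗-distribˡ-⊖ M N P x y =
  trans (sum-cong-≗ (λ z → distrib (M x z) (N z y) (P z y)))
        (sum-sub (λ z → M x z * N z y) (λ z → M x z * P z y))
  where
  distrib : ∀ a b c → a * (b - c) ≡ a * b - a * c
  distrib = solve-∀

⊗-distribʳ-⊖ : ∀ {m} (M N P : Mat m) → (M ⊖ N) ⊗ P ≐ M ⊗ P ⊖ N ⊗ P
⊗-distribʳ-⊖ M N P x y =
  trans (sum-cong-≗ (λ z → distrib (M x z) (N x z) (P z y)))
        (sum-sub (λ z → M x z * P z y) (λ z → N x z * P z y))
  where
  distrib : ∀ a b c → (a - b) * c ≡ a * c - b * c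
  distrib = solve-∀

⊗-scalarˡ : ∀ {m} (k : ℤ) (M N : Mat m) → (k ⊙ M) ⊗ N ≐ k ⊙ (M ⊗ N)
⊗-scalarˡ k M N x y =
  trans (sum-cong-≗ (λ z → ℤP.*-assoc k (M x z) (N z y)))
        (sym (*-distribˡ-sum k (λ z → M x z * N z y)))

⊗-scalarʳ : ∀ {m} (k : ℤ) (M N : Mat m) → M ⊗ (k ⊙ N) ≐ k ⊙ (M ⊗ N)
⊗-scalarʳ k M N x y =
  trans (sum-cong-≗ (λ z → exchange (M x z) k (N z y)))
        (sym (*-distribˡ-sum k (λ z → M x z * N z y)))
  where
  exchange : ∀ a k b → a * (k * b) ≡ k * (a * b)
  exchange = solve-∀

row-sum-⊗ : ∀ {m} (M N : Mat m) x →
  sum (λ y → (M ⊗ N) x y) ≡ sum (λ z → M x z * sum (λ y → N z y))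
row-sum-⊗ M N x =
  trans (∑-comm (λ y z → M x z * N z y))
        (sum-cong-≗ (λ z → sym (*-distribˡ-sum (M x z) (λ y → N z y))))

eigen-product : ∀ {m} (X D : Mat m) θ → X ⊗ D ≐ θ ⊙ D → ∀ N → X ⊗ (D ⊗ N) ≐ θ ⊙ (D ⊗ N)
eigen-product X D θ eigen N = begin
  X ⊗ (D ⊗ N)   ≈⟨ ≐-sym (⊗-assoc X D N) ⟩
  X ⊗ D ⊗ N     ≈⟨ ⊗-congˡ N eigen ⟩
  (θ ⊙ D) ⊗ N   ≈⟨ ⊗-scalarˡ θ D N ⟩
  θ ⊙ (D ⊗ N)   ∎
  where open ≐-Reasoning

eigen-square : ∀ {m} (X D : Mat m) θ → X ⊗ D ≐ θ ⊙ D → X ⊗ X ⊗ D ≐ (θ * θ) ⊙ D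
eigen-square X D θ eigen = begin
  X ⊗ X ⊗ D        ≈⟨ ⊗-assoc X X D ⟩
  X ⊗ (X ⊗ D)      ≈⟨ ⊗-congʳ X eigen ⟩
  X ⊗ (θ ⊙ D)      ≈⟨ ⊗-scalarʳ θ X D ⟩
  θ ⊙ (X ⊗ D)      ≈⟨ (λ x y → cong (θ *_) (eigen x y)) ⟩
  θ ⊙ (θ ⊙ D)      ≈⟨ (λ x y → sym (ℤP.*-assoc θ θ (D x y))) ⟩
  (θ * θ) ⊙ D      ∎
  where open ≐-Reasoning

eigen-squares : ∀ {m} (X D E : Mat m) θ μ → X ⊗ D ≐ θ ⊙ D → X ⊗ E ≐ μ ⊙ E →
  X ⊗ (D ⊗ D ⊕ E ⊗ E) ≐ θ ⊙ (D ⊗ D) ⊕ μ ⊙ (E ⊗ E)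
eigen-squares X D E θ μ eigen-D eigen-E = begin
  X ⊗ (D ⊗ D ⊕ E ⊗ E)          ≈⟨ ⊗-distribˡ-⊕ X (D ⊗ D) (E ⊗ E) ⟩
  X ⊗ (D ⊗ D) ⊕ X ⊗ (E ⊗ E)    ≈⟨ ⊕-cong (eigen-product X D θ eigen-D D) (eigen-product X E μ eigen-E E) ⟩
  θ ⊙ (D ⊗ D) ⊕ μ ⊙ (E ⊗ E)    ∎
  where open ≐-Reasoning

-- Transitive triangles x → y, x → z, y → z are counted in two ways:
-- with x as source, or with z as source.
transitive-triangles : ∀ {m} (A : Mat m) →
  sum (λ x → sum (λ y → A x y * (A ⊗ (λ u v → A v u)) x y)) ≡
  sum (λ x → sum (λ y → A x y * ((λ u v → A v u) ⊗ A) x y))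
transitive-triangles A = begin
  sum (λ x → sum (λ y → A x y * sum (λ z → A x z * A y z)))   ≡⟨ expand (λ x y z → A x z * A y z) ⟩
  sum (λ x → sum (λ y → sum (λ z → A x y * (A x z * A y z)))) ≡⟨ rotate (λ x y z → A x y * (A x z * A y z)) ⟩
  sum (λ y → sum (λ z → sum (λ x → A x y * (A x z * A y z))))
    ≡⟨ sum-cong-≗ (λ y → sum-cong-≗ (λ z → sum-cong-≗ (λ x → reorder (A x y) (A x z) (A y z)))) ⟩
  sum (λ y → sum (λ z → sum (λ x → A y z * (A x y * A x z)))) ≡⟨ sym (expand (λ y z x → A x y * A x z)) ⟩
  sum (λ y → sum (λ z → A y z * sum (λ x → A x y * A x z)))   ∎
  where
  open ≡-Reasoning
  expand : ∀ (F : _ → _ → _ → ℤ) →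
    sum (λ x → sum (λ y → A x y * sum (λ z → F x y z))) ≡ sum (λ x → sum (λ y → sum (λ z → A x y * F x y z)))
  expand F = sum-cong-≗ (λ x → sum-cong-≗ (λ y → *-distribˡ-sum (A x y) (F x y)))
  rotate : ∀ (G : _ → _ → _ → ℤ) →
    sum (λ x → sum (λ y → sum (λ z → G x y z))) ≡ sum (λ y → sum (λ z → sum (λ x → G x y z)))
  rotate G = trans (∑-comm (λ x y → sum (G x y))) (sum-cong-≗ (λ y → ∑-comm (λ x z → G x y z)))
  reorder : ∀ p q r → p * (q * r) ≡ r * (p * q)
  reorder = solve-∀

-- General facts on association schemes on a nonempty point set

module SchemeFacts {m d} {r : Fin (suc m) → Fin (suc m) → Fin (suc d)}
                   (S : IsAssocScheme r) where
  open IsAssocScheme S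

  adjacency : Fin (suc d) → Mat (suc m)
  adjacency i x y = χ ⌊ r x y ≟ i ⌋

  p : (i j k : Fin (suc d)) → ℕ
  p i j k = proj₁ (intersection i j k)

  product-formula : ∀ i j → adjacency i ⊗ adjacency j ≐ λ x y → + p i j (r x y)
  product-formula i j x y = begin
    sum (λ z → χ ⌊ r x z ≟ i ⌋ * χ ⌊ r z y ≟ j ⌋) ≡⟨ sum-cong-≗ (λ z → sym (χ-∧ ⌊ r x z ≟ i ⌋ ⌊ r z y ≟ j ⌋)) ⟩
    sum (λ z → χ (⌊ r x z ≟ i ⌋ ∧ ⌊ r z y ≟ j ⌋)) ≡⟨ sym (count-sum (λ z → ⌊ r x z ≟ i ⌋ ∧ ⌊ r z y ≟ j ⌋)) ⟩
    + count (λ z → ⌊ r x z ≟ i ⌋ ∧ ⌊ r z y ≟ j ⌋) ≡⟨ cong +_ (proj₂ (intersection i j (r x y)) x y refl) ⟩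
    + p i j (r x y)                               ∎
    where open ≡-Reasoning

  valency : Fin (suc d) → ℕ
  valency i = p i (tr i) zero

  row-count : ∀ i x → count (λ z → ⌊ r x z ≟ i ⌋) ≡ valency i
  row-count i x =
    trans (count-cong (λ z → sym (back-and-forth z)))
          (proj₂ (intersection i (tr i) zero) x x (Equivalence.from (diagonal x x) refl))
    where
    back-and-forth : ∀ z → ⌊ r x z ≟ i ⌋ ∧ ⌊ r z x ≟ tr i ⌋ ≡ ⌊ r x z ≟ i ⌋
    back-and-forth z =
      trans (cong (⌊ r x z ≟ i ⌋ ∧_) (sym (⌊⌋-⇔ (proj₂ (transpose i) z x) (r x z ≟ i) (r z x ≟ tr i))))
            (∧-idem ⌊ r x z ≟ i ⌋)

  row-sum : ∀ i x → sum (λ z → adjacency i x z) ≡ + valency i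
  row-sum i x = trans (sym (count-sum (λ z → ⌊ r x z ≟ i ⌋))) (cong +_ (row-count i x))

  class-row-sum : ∀ (H : Fin (suc d) → ℤ) x →
    sum (λ z → H (r x z)) ≡ sum (λ i → H i * + valency i)
  class-row-sum H x = begin
    sum (λ z → H (r x z))                             ≡⟨ sum-cong-≗ (λ z → sym (sum-δ H (r x z))) ⟩
    sum (λ z → sum (λ i → H i * adjacency i x z))     ≡⟨ ∑-comm (λ z i → H i * adjacency i x z) ⟩
    sum (λ i → sum (λ z → H i * adjacency i x z))     ≡⟨ sum-cong-≗ (λ i → sym (*-distribˡ-sum (H i) (adjacency i x))) ⟩
    sum (λ i → H i * sum (λ z → adjacency i x z))     ≡⟨ sum-cong-≗ (λ i → cong (H i *_) (row-sum i x)) ⟩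
    sum (λ i → H i * + valency i)                     ∎
    where open ≡-Reasoning

  valency-transpose : ∀ i j → (∀ x y → r x y ≡ i ⇔ r y x ≡ j) → valency j ≡ valency i
  valency-transpose i j i⇔j = ℤP.+-injective (cancel-positive (m , refl) (begin
    + suc m * + valency j                     ≡⟨ sym (sum-const (suc m) (+ valency j)) ⟩
    sum {suc m} (λ x → + valency j)           ≡⟨ sum-cong-≗ (λ x → sym (row-sum j x)) ⟩
    sum (λ x → sum (λ z → χ ⌊ r x z ≟ j ⌋))   ≡⟨ sum-cong-≗ (λ x → sum-cong-≗ (λ z → cong χ (transposed x z))) ⟩
    sum (λ x → sum (λ z → χ ⌊ r z x ≟ i ⌋))   ≡⟨ ∑-comm (λ x z → χ ⌊ r z x ≟ i ⌋) ⟩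
    sum (λ z → sum (λ x → χ ⌊ r z x ≟ i ⌋))   ≡⟨ sum-cong-≗ (λ z → row-sum i z) ⟩
    sum {suc m} (λ z → + valency i)           ≡⟨ sum-const (suc m) (+ valency i) ⟩
    + suc m * + valency i                     ∎))
    where
    open ≡-Reasoning
    transposed : ∀ x z → ⌊ r x z ≟ j ⌋ ≡ ⌊ r z x ≟ i ⌋
    transposed x z = ⌊⌋-⇔ (⇔-sym (i⇔j z x)) (r x z ≟ j) (r z x ≟ i)

module Transposition {m d} {r : Fin (suc m) → Fin (suc m) → Fin (suc d)} (S : IsAssocScheme r) where
  open IsAssocScheme S

  tr-flip : ∀ x y → r x y ≡ tr (r y x)
  tr-flip x y = Equivalence.to (proj₂ (transpose (r y x)) x y) refl

  tr-involutive : ∀ i → tr (tr i) ≡ i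
  tr-involutive i =
    let (x , y , rxy≡i) = nonempty i
    in trans (cong tr (trans (cong tr (sym rxy≡i)) (sym (tr-flip y x)))) (trans (sym (tr-flip x y)) rxy≡i)

  tr-zero : tr zero ≡ zero
  tr-zero = trans (cong tr (sym r-diagonal)) (trans (sym (tr-flip zero zero)) r-diagonal)
    where
    r-diagonal : r zero zero ≡ zero
    r-diagonal = Equivalence.from (diagonal zero zero) refl

  tr-fixed : SkewSymmetric r → ∀ i → tr i ≡ i → i ≡ zero
  tr-fixed skew i tr-i≡i = skew i (λ x y → mk⇔
    (λ ryx≡i → trans (tr-flip x y) (trans (cong tr ryx≡i) tr-i≡i))
    (λ rxy≡i → trans (tr-flip y x) (trans (cong tr rxy≡i) tr-i≡i)))

-- The relations of a skew-symmetric 4-class scheme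

data Class : Set where
  o a a' b b' : Class

_ᵀ : Class → Class
o  ᵀ = o
a  ᵀ = a'
a' ᵀ = a
b  ᵀ = b'
b' ᵀ = b

swap : Class → Class
swap o  = o
swap a  = b
swap a' = b'
swap b  = a
swap b' = a'

code : Class → Fin 5
code o  = 0F
code a  = 1F
code a' = 2F
code b  = 3F
code b' = 4F

decode : Fin 5 → Class
decode 0F = o
decode 1F = a
decode 2F = a'
decode 3F = b
decode 4F = b'

decode-code : ∀ w → decode (code w) ≡ w
decode-code o  = refl
decode-code a  = refl
decode-code a' = refl
decode-code b  = refl
decode-code b' = refl

code-injective : ∀ {v w} → code v ≡ code w → v ≡ w
code-injective {v} {w} eq = trans (sym (decode-code v)) (trans (cong decode eq) (decode-code w))

infix 4 _≟ᶜ_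

_≟ᶜ_ : (v w : Class) → Dec (v ≡ w)
v ≟ᶜ w = map′ code-injective (cong code) (code v ≟ code w)

all-classes? : {P : Class → Set} → U.Decidable P → Dec (∀ w → P w)
all-classes? {P} P? =
  map′ (λ all w → subst P (decode-code w) (all (code w))) (λ all i → all (decode i)) (all? (P? ∘ decode))

any-class? : {P : Class → Set} → U.Decidable P → Dec (∃ P)
any-class? {P} P? = map′ (λ { (i , Pi) → decode i , Pi }) (λ { (w , Pw) → code w , subst P (sym (decode-code w)) Pw })
                         (any? (P? ∘ decode))

check : ∀ {P : Class → Set} (P? : U.Decidable P) → {True (all-classes? P?)} → ∀ w → P w
check P? {holds} = toWitness holds

check₂ : ∀ {P : Class → Class → Set} (P? : ∀ u v → Dec (P u v)) →
  {True (all-classes? (λ u → all-classes? (P? u)))} → ∀ u v → P u v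
check₂ P? {holds} = toWitness holds

ᵀ-involutive : ∀ w → w ᵀ ᵀ ≡ w
ᵀ-involutive = check (λ w → w ᵀ ᵀ ≟ᶜ w)

ᵀ-injective : ∀ {u v} → u ᵀ ≡ v ᵀ → u ≡ v
ᵀ-injective {u} {v} e = trans (sym (ᵀ-involutive u)) (trans (cong _ᵀ e) (ᵀ-involutive v))

swap-ᵀ : ∀ w → swap (w ᵀ) ≡ swap w ᵀ
swap-ᵀ = check (λ w → swap (w ᵀ) ≟ᶜ swap w ᵀ)

swap-swap : ∀ w → swap (swap w) ≡ w
swap-swap = check (λ w → swap (swap w) ≟ᶜ w)

swap-o : ∀ w → swap w ≡ o → w ≡ o
swap-o = check (λ w → (swap w ≟ᶜ o) →-dec (w ≟ᶜ o))

part : ∀ {e} → (Class → Fin (suc e)) → Fin (suc e) → Class → ℤ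
part g j w = χ ⌊ g w ≟ j ⌋

δ : Class → Class → ℤ
δ w = part code (code w)

δo-ᵀ : ∀ w → δ o (w ᵀ) ≡ δ o w
δo-ᵀ = check (λ w → δ o (w ᵀ) ℤP.≟ δ o w)

δo-off : ∀ w → w ≢ o → δ o w ≡ 0ℤ
δo-off w w≢o = cong χ (⌊⌋-false (code w ≟ 0F) (w≢o ∘ code-injective))

record Admissible {e} (g : Class → Fin (suc e)) : Set where
  field
    part-nonempty : ∀ j → ∃ λ w → g w ≡ j
    part-of-o     : ∀ w → g w ≡ zero → w ≡ o
    o-in-zero     : g o ≡ zero
    gᵀ            : Fin (suc e) → Fin (suc e)
    transpose-parts : ∀ w → g (w ᵀ) ≡ gᵀ (g w)

admissible : ∀ {e} (g : Class → Fin (suc e)) (gᵀ : Fin (suc e) → Fin (suc e)) →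
  {True (all? (λ j → any-class? (λ w → g w ≟ j)))} →
  {True (all-classes? (λ w → (g w ≟ zero) →-dec (w ≟ᶜ o)))} →
  {True (g o ≟ zero)} →
  {True (all-classes? (λ w → g (w ᵀ) ≟ gᵀ (g w)))} → Admissible g
admissible g gᵀ {nonempty} {of-o} {in-zero} {transposes} = record
  { part-nonempty   = toWitness nonempty
  ; part-of-o       = toWitness of-o
  ; o-in-zero       = toWitness in-zero
  ; gᵀ              = gᵀ
  ; transpose-parts = toWitness transposes
  }

admissible-swap : ∀ {e} {g : Class → Fin (suc e)} → Admissible g → Admissible (g ∘ swap)
admissible-swap {g = g} G = record
  { part-nonempty   = λ j → let (w , gw≡j) = part-nonempty j in swap w , trans (cong g (swap-swap w)) gw≡j
  ; part-of-o       = λ w g[sw]≡0 → swap-o w (part-of-o (swap w) g[sw]≡0)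
  ; o-in-zero       = o-in-zero
  ; gᵀ              = gᵀ
  ; transpose-parts = λ w → trans (cong g (swap-ᵀ w)) (transpose-parts (swap w))
  }
  where open Admissible G

singletons : Admissible code
singletons = admissible code (λ i → code (decode i ᵀ))

flip₃ : Fin 3 → Fin 3
flip₃ 0F = 0F
flip₃ 1F = 2F
flip₃ 2F = 1F

tournament-ab tournament-ab' : Class → Fin 3
tournament-ab o  = 0F
tournament-ab a  = 1F
tournament-ab a' = 2F
tournament-ab b  = 1F
tournament-ab b' = 2F
tournament-ab' o  = 0F
tournament-ab' a  = 1F
tournament-ab' a' = 2F
tournament-ab' b  = 2F
tournament-ab' b' = 1F

keep-a : Class → Fin 4
keep-a o  = 0F
keep-a a  = 1F
keep-a a' = 2F
keep-a b  = 3F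
keep-a b' = 3F

flip₄ : Fin 4 → Fin 4
flip₄ 0F = 0F
flip₄ 1F = 2F
flip₄ 2F = 1F
flip₄ 3F = 3F

ab-admissible : Admissible tournament-ab
ab-admissible = admissible tournament-ab flip₃

ab'-admissible : Admissible tournament-ab'
ab'-admissible = admissible tournament-ab' flip₃

keep-a-admissible : Admissible keep-a
keep-a-admissible = admissible keep-a flip₄

record SkewAmorphous {N} (c : Fin N → Fin N → Class) : Set where
  field
    diagonal   : ∀ x y → c x y ≡ o → x ≡ y
    reflexive  : ∀ x → c x x ≡ o
    transposed : ∀ x y → c y x ≡ c x y ᵀ
    occurs     : ∀ w → ∃ λ x → ∃ λ y → c x y ≡ w
    fusion     : ∀ {e} (g : Class → Fin (suc e)) → Admissible g →
                 IsAssocScheme (λ x y → g (c x y))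

swapped : ∀ {N} {c : Fin N → Fin N → Class} → SkewAmorphous c → SkewAmorphous (λ x y → swap (c x y))
swapped {c = c} A = record
  { diagonal   = λ x y e → diagonal x y (swap-o (c x y) e)
  ; reflexive  = λ x → cong swap (reflexive x)
  ; transposed = λ x y → trans (cong swap (transposed x y)) (swap-ᵀ (c x y))
  ; occurs     = λ w → let (x , y , e) = occurs (swap w) in x , y , trans (cong swap e) (swap-swap w)
  ; fusion     = λ g G → fusion (g ∘ swap) (admissible-swap G)
  }
  where open SkewAmorphous A

-- Counting in a skew-symmetric amorphous 4-class scheme

module Labelled {m} {c : Fin (suc m) → Fin (suc m) → Class} (A : SkewAmorphous c) where
  open SkewAmorphous A

  N : ℤ
  N = + suc m

  ⟦_⟧ : (Class → ℤ) → Mat (suc m)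
  ⟦ h ⟧ x y = h (c x y)

  module Fusion {e} (g : Class → Fin (suc e)) (G : Admissible g) = SchemeFacts (fusion g G)

  part-product : ∀ {e} (g : Class → Fin (suc e)) (G : Admissible g) i j →
    ⟦ part g i ⟧ ⊗ ⟦ part g j ⟧ ≐ ⟦ (λ w → + Fusion.p g G i j (g w)) ⟧
  part-product g G = Fusion.product-formula g G

  module Singletons = Fusion code singletons

  δo-off-diagonal : ∀ x z → z ≢ x → δ o (c x z) ≡ 0ℤ
  δo-off-diagonal x z z≢x = δo-off (c x z) (λ e → z≢x (sym (diagonal x z e)))

  δo-diagonal : ∀ x → δ o (c x x) ≡ 1ℤ
  δo-diagonal x = cong (δ o) (reflexive x)

  identity-left : ∀ (M : Mat (suc m)) → ⟦ δ o ⟧ ⊗ M ≐ M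
  identity-left M x y = begin
    sum (λ z → δ o (c x z) * M z y) ≡⟨ sum-single (λ z → δ o (c x z) * M z y) x vanish ⟩
    δ o (c x x) * M x y             ≡⟨ cong (_* M x y) (δo-diagonal x) ⟩
    1ℤ * M x y                      ≡⟨ ℤP.*-identityˡ (M x y) ⟩
    M x y                           ∎
    where
    open ≡-Reasoning
    vanish : ∀ z → z ≢ x → δ o (c x z) * M z y ≡ 0ℤ
    vanish z z≢x = cong (_* M z y) (δo-off-diagonal x z z≢x)

  identity-right : ∀ (M : Mat (suc m)) → M ⊗ ⟦ δ o ⟧ ≐ M
  identity-right M x y = begin
    sum (λ z → M x z * δ o (c z y)) ≡⟨ sum-single (λ z → M x z * δ o (c z y)) y vanish ⟩
    M x y * δ o (c y y)             ≡⟨ cong (M x y *_) (δo-diagonal y) ⟩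
    M x y * 1ℤ                      ≡⟨ ℤP.*-identityʳ (M x y) ⟩
    M x y                           ∎
    where
    open ≡-Reasoning
    vanish : ∀ z → z ≢ y → M x z * δ o (c z y) ≡ 0ℤ
    vanish z z≢y = trans (cong (M x z *_) (trans (cong (δ o) (transposed y z))
                                                 (trans (δo-ᵀ (c y z)) (δo-off-diagonal y z z≢y))))
                         (ℤP.*-zeroʳ (M x z))

  valency : Class → ℕ
  valency w = Singletons.valency (code w)

  valency-o : valency o ≡ 1
  valency-o = ℤP.+-injective (trans (sym (Singletons.row-sum 0F zero)) (begin
    sum (λ z → δ o (c zero z)) ≡⟨ sum-single (λ z → δ o (c zero z)) zero (δo-off-diagonal zero) ⟩
    δ o (c zero zero)          ≡⟨ δo-diagonal zero ⟩
    1ℤ                         ∎))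
    where open ≡-Reasoning

  valency-ᵀ : ∀ w → valency (w ᵀ) ≡ valency w
  valency-ᵀ w = Singletons.valency-transpose (code w) (code (w ᵀ)) (λ x y → mk⇔ (to x y) (from x y))
    where
    to : ∀ x y → code (c x y) ≡ code w → code (c y x) ≡ code (w ᵀ)
    to x y e = cong code (trans (transposed x y) (cong _ᵀ (code-injective e)))
    from : ∀ x y → code (c y x) ≡ code (w ᵀ) → code (c x y) ≡ code w
    from x y e = cong code (ᵀ-injective (trans (sym (transposed x y)) (code-injective e)))

  valency-positive : ∀ w → ∃ λ j → valency w ≡ suc j
  valency-positive w =
    let (x , y , cxy≡w) = occurs w
        (j , count≡) = count-positive (λ z → ⌊ code (c x z) ≟ code w ⌋) y (⌊⌋-true (code (c x y) ≟ code w) (cong code cxy≡w))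
    in j , trans (sym (Singletons.row-count (code w) x)) count≡

  k₁ k₂ : ℤ
  k₁ = + valency a
  k₂ = + valency b

  k₁-positive : ∃ λ j → k₁ ≡ + suc j
  k₁-positive = let (j , eq) = valency-positive a in j , cong +_ eq

  k₂-positive : ∃ λ j → k₂ ≡ + suc j
  k₂-positive = let (j , eq) = valency-positive b in j , cong +_ eq

  K : ℤ
  K = k₁ + k₂

  K-positive : ∃ λ j → K ≡ + suc j
  K-positive = let (j₁ , e₁) = k₁-positive ; (j₂ , e₂) = k₂-positive in _ , cong₂ _+_ e₁ e₂

  row : (Class → ℤ) → ℤ
  row h = h o + k₁ * (h a + h a') + k₂ * (h b + h b')

  row-sum : ∀ h x → sum (λ z → h (c x z)) ≡ row h
  row-sum h x = begin
    sum (λ z → h (c x z))                 ≡⟨ sum-cong-≗ (λ z → cong h (sym (decode-code (c x z)))) ⟩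
    sum (λ z → h (decode (code (c x z)))) ≡⟨ Singletons.class-row-sum (h ∘ decode) x ⟩
    h o * + valency o + (h a * k₁ + (h a' * + valency a' + (h b * k₂ + (h b' * + valency b' + 0ℤ))))
      ≡⟨ collect (h o) (h a) (h a') (h b) (h b') _ _ _ valency-o (valency-ᵀ a) (valency-ᵀ b) ⟩
    row h                                 ∎
    where
    open ≡-Reasoning
    collect : ∀ ho ha ha′ hb hb′ v₀ v₂ v₄ → v₀ ≡ 1 → v₂ ≡ valency a → v₄ ≡ valency b →
      ho * + v₀ + (ha * k₁ + (ha′ * + v₂ + (hb * k₂ + (hb′ * + v₄ + 0ℤ)))) ≡
      ho + k₁ * (ha + ha′) + k₂ * (hb + hb′)
    collect ho ha ha′ hb hb′ _ _ _ refl refl refl = ring ho ha ha′ hb hb′ k₁ k₂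
      where
      ring : ∀ ho ha ha′ hb hb′ k₁ k₂ →
        ho * 1ℤ + (ha * k₁ + (ha′ * k₁ + (hb * k₂ + (hb′ * k₂ + 0ℤ)))) ≡
        ho + k₁ * (ha + ha′) + k₂ * (hb + hb′)
      ring = solve-∀

  row-cong : ∀ {h h′} → (∀ w → h w ≡ h′ w) → row h ≡ row h′
  row-cong eq = cong₂ _+_ (cong₂ _+_ (eq o) (cong (k₁ *_) (cong₂ _+_ (eq a) (eq a'))))
                          (cong (k₂ *_) (cong₂ _+_ (eq b) (eq b')))

  row-pairs : ∀ h {v₀ s} → h o ≡ v₀ → (∀ w → w ≢ o → h w + h (w ᵀ) ≡ s) → row h ≡ v₀ + K * s
  row-pairs h {v₀} {s} h-o pairs = begin
    h o + k₁ * (h a + h a') + k₂ * (h b + h b') ≡⟨ cong₂ _+_ (cong₂ _+_ h-o (cong (k₁ *_) (pairs a (λ ())))) (cong (k₂ *_) (pairs b (λ ()))) ⟩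
    v₀ + k₁ * s + k₂ * s                        ≡⟨ ring v₀ s k₁ k₂ ⟩
    v₀ + K * s                                  ∎
    where
    open ≡-Reasoning
    ring : ∀ v₀ s k₁ k₂ → v₀ + k₁ * s + k₂ * s ≡ v₀ + (k₁ + k₂) * s
    ring = solve-∀

  row-odd : ∀ h → h o ≡ 0ℤ → (∀ w → h (w ᵀ) ≡ - h w) → row h ≡ 0ℤ
  row-odd h h-o h-ᵀ =
    trans (row-pairs h h-o (λ w _ → trans (cong (_+_ (h w)) (h-ᵀ w)) (ℤP.+-inverseʳ (h w))))
          (trans (ℤP.+-identityˡ (K * 0ℤ)) (ℤP.*-zeroʳ K))

  column-sum : ∀ h y → sum (λ z → h (c z y)) ≡ row (λ w → h (w ᵀ))
  column-sum h y = trans (sum-cong-≗ (λ z → cong h (transposed y z))) (row-sum (λ w → h (w ᵀ)) y)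

  N-formula : N ≡ 1ℤ + + 2 * (k₁ + k₂)
  N-formula = begin
    N                       ≡⟨ sym (ℤP.*-identityʳ N) ⟩
    N * 1ℤ                  ≡⟨ sym (sum-const (suc m) 1ℤ) ⟩
    sum {suc m} (λ _ → 1ℤ)  ≡⟨ row-sum (λ _ → 1ℤ) zero ⟩
    row (λ _ → 1ℤ)          ≡⟨ ring k₁ k₂ ⟩
    1ℤ + + 2 * (k₁ + k₂)    ∎
    where
    open ≡-Reasoning
    ring : ∀ k₁ k₂ → 1ℤ + k₁ * (1ℤ + 1ℤ) + k₂ * (1ℤ + 1ℤ) ≡ 1ℤ + + 2 * (k₁ + k₂)
    ring = solve-∀

  diagonal-product : ∀ h₁ h₂ x → (⟦ h₁ ⟧ ⊗ ⟦ h₂ ⟧) x x ≡ row (λ w → h₁ w * h₂ (w ᵀ))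
  diagonal-product h₁ h₂ x =
    trans (sum-cong-≗ (λ z → cong (λ t → h₁ (c x z) * h₂ t) (transposed x z)))
          (row-sum (λ w → h₁ w * h₂ (w ᵀ)) x)

  row-sum-product : ∀ h₁ h₂ x → sum (λ y → (⟦ h₁ ⟧ ⊗ ⟦ h₂ ⟧) x y) ≡ row h₁ * row h₂
  row-sum-product h₁ h₂ x = begin
    sum (λ y → (⟦ h₁ ⟧ ⊗ ⟦ h₂ ⟧) x y)               ≡⟨ row-sum-⊗ ⟦ h₁ ⟧ ⟦ h₂ ⟧ x ⟩
    sum (λ z → h₁ (c x z) * sum (λ y → h₂ (c z y))) ≡⟨ sum-cong-≗ (λ z → cong (h₁ (c x z) *_) (row-sum h₂ z)) ⟩
    sum (λ z → h₁ (c x z) * row h₂)                 ≡⟨ sym (*-distribʳ-sum (row h₂) (λ z → h₁ (c x z))) ⟩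
    sum (λ z → h₁ (c x z)) * row h₂                 ≡⟨ cong (_* row h₂) (row-sum h₁ x) ⟩
    row h₁ * row h₂                                 ∎
    where open ≡-Reasoning

  product-symmetric : ∀ h₁ h₂ → (∀ u v → h₁ u * h₂ v ≡ h₁ (v ᵀ) * h₂ (u ᵀ)) →
    ∀ x y → (⟦ h₁ ⟧ ⊗ ⟦ h₂ ⟧) x y ≡ (⟦ h₁ ⟧ ⊗ ⟦ h₂ ⟧) y x
  product-symmetric h₁ h₂ invariant x y = sum-cong-≗ (λ z →
    trans (invariant (c x z) (c z y))
          (sym (cong₂ (λ u v → h₁ u * h₂ v) (transposed z y) (transposed x z))))

  product-transpose : ∀ h₁ h₂ x y →
    (⟦ h₁ ⟧ ⊗ ⟦ h₂ ⟧) y x ≡ (⟦ (λ w → h₂ (w ᵀ)) ⟧ ⊗ ⟦ (λ w → h₁ (w ᵀ)) ⟧) x y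
  product-transpose h₁ h₂ x y = sum-cong-≗ (λ z →
    trans (ℤP.*-comm (h₁ (c y z)) (h₂ (c z x)))
          (cong₂ (λ u v → h₂ u * h₁ v) (transposed x z) (transposed z y)))

  symmetric-balanced : ∀ (h : Class → ℤ) → (∀ x y → h (c x y) ≡ h (c y x)) → h a' ≡ h a
  symmetric-balanced h sym-h =
    let (x , y , cxy≡a) = occurs a
    in begin
      h a'         ≡⟨ cong (λ w → h (w ᵀ)) (sym cxy≡a) ⟩
      h (c x y ᵀ)  ≡⟨ cong h (sym (transposed x y)) ⟩
      h (c y x)    ≡⟨ sym (sym-h x y) ⟩
      h (c x y)    ≡⟨ cong h cxy≡a ⟩
      h a          ∎
    where open ≡-Reasoning

  module Product (h₁ h₂ H : Class → ℤ) (product : ⟦ h₁ ⟧ ⊗ ⟦ h₂ ⟧ ≐ ⟦ H ⟧) where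
    value-o : H o ≡ row (λ w → h₁ w * h₂ (w ᵀ))
    value-o = begin
      H o                        ≡⟨ cong H (sym (reflexive zero)) ⟩
      H (c zero zero)            ≡⟨ sym (product zero zero) ⟩
      (⟦ h₁ ⟧ ⊗ ⟦ h₂ ⟧) zero zero ≡⟨ diagonal-product h₁ h₂ zero ⟩
      row (λ w → h₁ w * h₂ (w ᵀ)) ∎
      where open ≡-Reasoning

    row-product : row H ≡ row h₁ * row h₂
    row-product = begin
      row H                                 ≡⟨ sym (row-sum H zero) ⟩
      sum (λ y → H (c zero y))              ≡⟨ sum-cong-≗ (λ y → sym (product zero y)) ⟩
      sum (λ y → (⟦ h₁ ⟧ ⊗ ⟦ h₂ ⟧) zero y)  ≡⟨ row-sum-product h₁ h₂ zero ⟩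
      row h₁ * row h₂                       ∎
      where open ≡-Reasoning

    symmetric : (∀ u v → h₁ u * h₂ v ≡ h₁ (v ᵀ) * h₂ (u ᵀ)) → ∀ x y → H (c x y) ≡ H (c y x)
    symmetric invariant x y =
      trans (sym (product x y)) (trans (product-symmetric h₁ h₂ invariant x y) (product y x))

  -- Doubly regular tournaments.
  module Tournament (g : Class → Fin 3) (G : Admissible g) (g-ᵀ : ∀ w → g (w ᵀ) ≡ flip₃ (g w)) where
    open Admissible G using (part-of-o; o-in-zero)
    open Fusion g G using (p)

    t t̄ d : Class → ℤ
    t  = part g 1F
    t̄  = part g 2F
    d w = t w - t̄ w

    off-o : ∀ w → w ≢ o → (g w ≡ 1F × g (w ᵀ) ≡ 2F) ⊎ (g w ≡ 2F × g (w ᵀ) ≡ 1F)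
    off-o w w≢o with g w in gw
    ... | 0F = ⊥-elim (w≢o (part-of-o w gw))
    ... | 1F = inj₁ (refl , trans (g-ᵀ w) (cong flip₃ gw))
    ... | 2F = inj₂ (refl , trans (g-ᵀ w) (cong flip₃ gw))

    pair-sum : ∀ (F : Fin 3 → ℤ) w → w ≢ o → F (g w) + F (g (w ᵀ)) ≡ F 1F + F 2F
    pair-sum F w w≢o with off-o w w≢o
    ... | inj₁ (e , eᵀ) = cong₂ (λ i j → F i + F j) e eᵀ
    ... | inj₂ (e , eᵀ) = trans (cong₂ (λ i j → F i + F j) e eᵀ) (ℤP.+-comm (F 2F) (F 1F))

    fused-row : ∀ (F : Fin 3 → ℤ) → row (F ∘ g) ≡ F 0F + K * (F 1F + F 2F)
    fused-row F = row-pairs (F ∘ g) (cong F o-in-zero) (pair-sum F)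

    fused-symmetric : ∀ (F : Fin 3 → ℤ) → (∀ x y → F (g (c x y)) ≡ F (g (c y x))) → F 2F ≡ F 1F
    fused-symmetric F sym-F with off-o a (λ ()) | symmetric-balanced (F ∘ g) sym-F
    ... | inj₁ (e , eᵀ) | balanced = trans (cong F (sym eᵀ)) (trans balanced (cong F e))
    ... | inj₂ (e , eᵀ) | balanced = trans (cong F (sym e)) (trans (sym balanced) (cong F eᵀ))

    t̄-ᵀ : ∀ w → t̄ w ≡ t (w ᵀ)
    t̄-ᵀ w = trans (lemma (g w)) (cong (λ i → χ ⌊ i ≟ 1F ⌋) (sym (g-ᵀ w)))
      where
      lemma : ∀ i → χ ⌊ i ≟ 2F ⌋ ≡ χ ⌊ flip₃ i ≟ 1F ⌋
      lemma 0F = refl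
      lemma 1F = refl
      lemma 2F = refl

    δo-via-g : ∀ w → δ o w ≡ χ ⌊ g w ≟ 0F ⌋
    δo-via-g w = cong χ (⌊⌋-⇔ (mk⇔ (λ e → trans (cong g (code-injective e)) o-in-zero)
                                    (λ e → cong code (part-of-o w e)))
                               (code w ≟ 0F) (g w ≟ 0F))

    d-ᵀ : ∀ w → d (w ᵀ) ≡ - d w
    d-ᵀ w = begin
      t (w ᵀ) - t̄ (w ᵀ)     ≡⟨ cong₂ _-_ (sym (t̄-ᵀ w)) (trans (t̄-ᵀ (w ᵀ)) (cong t (ᵀ-involutive w))) ⟩
      t̄ w - t w             ≡⟨ ring (t w) (t̄ w) ⟩
      - (t w - t̄ w)         ∎
      where
      open ≡-Reasoning
      ring : ∀ x y → y - x ≡ - (x - y)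
      ring = solve-∀

    d-o : d o ≡ 0ℤ
    d-o = cong (λ i → χ ⌊ i ≟ 1F ⌋ - χ ⌊ i ≟ 2F ⌋) o-in-zero

    d-times-dᵀ : ∀ w → d w * d (w ᵀ) ≡ δ o w - 1ℤ
    d-times-dᵀ w = begin
      d w * d (w ᵀ)       ≡⟨ cong (d w *_) (d-ᵀ w) ⟩
      d w * - d w         ≡⟨ lemma (g w) ⟩
      χ ⌊ g w ≟ 0F ⌋ - 1ℤ ≡⟨ cong (_- 1ℤ) (sym (δo-via-g w)) ⟩
      δ o w - 1ℤ          ∎
      where
      open ≡-Reasoning
      lemma : ∀ i → (χ ⌊ i ≟ 1F ⌋ - χ ⌊ i ≟ 2F ⌋) * - (χ ⌊ i ≟ 1F ⌋ - χ ⌊ i ≟ 2F ⌋) ≡ χ ⌊ i ≟ 0F ⌋ - 1ℤ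
      lemma 0F = refl
      lemma 1F = refl
      lemma 2F = refl

    H : Fin 3 → ℤ
    H k = (+ p 1F 1F k - + p 1F 2F k) - (+ p 2F 1F k - + p 2F 2F k)

    square-fused : ⟦ d ⟧ ⊗ ⟦ d ⟧ ≐ ⟦ H ∘ g ⟧
    square-fused = begin
      (⟦ t ⟧ ⊖ ⟦ t̄ ⟧) ⊗ (⟦ t ⟧ ⊖ ⟦ t̄ ⟧)
        ≈⟨ ⊗-distribʳ-⊖ ⟦ t ⟧ ⟦ t̄ ⟧ (⟦ t ⟧ ⊖ ⟦ t̄ ⟧) ⟩
      ⟦ t ⟧ ⊗ (⟦ t ⟧ ⊖ ⟦ t̄ ⟧) ⊖ ⟦ t̄ ⟧ ⊗ (⟦ t ⟧ ⊖ ⟦ t̄ ⟧)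
        ≈⟨ ⊖-cong (⊗-distribˡ-⊖ ⟦ t ⟧ ⟦ t ⟧ ⟦ t̄ ⟧) (⊗-distribˡ-⊖ ⟦ t̄ ⟧ ⟦ t ⟧ ⟦ t̄ ⟧) ⟩
      (⟦ t ⟧ ⊗ ⟦ t ⟧ ⊖ ⟦ t ⟧ ⊗ ⟦ t̄ ⟧) ⊖ (⟦ t̄ ⟧ ⊗ ⟦ t ⟧ ⊖ ⟦ t̄ ⟧ ⊗ ⟦ t̄ ⟧)
        ≈⟨ ⊖-cong (⊖-cong (part-product g G 1F 1F) (part-product g G 1F 2F))
                  (⊖-cong (part-product g G 2F 1F) (part-product g G 2F 2F)) ⟩
      ⟦ H ∘ g ⟧ ∎
      where open ≐-Reasoning

    module Square = Product d d (H ∘ g) square-fused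

    H-symmetric : ∀ x y → H (g (c x y)) ≡ H (g (c y x))
    H-symmetric = Square.symmetric invariant
      where
      invariant : ∀ u v → d u * d v ≡ d (v ᵀ) * d (u ᵀ)
      invariant u v = trans (ring (d u) (d v)) (sym (cong₂ _*_ (d-ᵀ v) (d-ᵀ u)))
        where
        ring : ∀ x y → x * y ≡ - y * - x
        ring = solve-∀

    H-o : H 0F ≡ - (+ 2 * K)
    H-o = begin
      H 0F                                 ≡⟨ cong H (sym o-in-zero) ⟩
      H (g o)                              ≡⟨ Square.value-o ⟩
      row (λ w → d w * d (w ᵀ))            ≡⟨ row-cong d-times-dᵀ ⟩
      row (λ w → δ o w - 1ℤ)               ≡⟨ ring k₁ k₂ ⟩
      - (+ 2 * K)                          ∎
      where
      open ≡-Reasoning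
      ring : ∀ k₁ k₂ → (1ℤ - 1ℤ) + k₁ * ((0ℤ - 1ℤ) + (0ℤ - 1ℤ)) + k₂ * ((0ℤ - 1ℤ) + (0ℤ - 1ℤ)) ≡ - (+ 2 * (k₁ + k₂))
      ring = solve-∀

    H-row : row (H ∘ g) ≡ 0ℤ
    H-row = begin
      row (H ∘ g)     ≡⟨ Square.row-product ⟩
      row d * row d   ≡⟨ cong (_* row d) (row-odd d d-o d-ᵀ) ⟩
      0ℤ * row d      ≡⟨ ℤP.*-zeroˡ (row d) ⟩
      0ℤ              ∎
      where open ≡-Reasoning

    -- From H 0 + K (H 1 + H 2) = 0, H 0 = −2K and H 2 = H 1.
    H-off : H 1F ≡ 1ℤ
    H-off = cancel-positive (1 , refl) (cancel-positive K-positive (begin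
      K * (+ 2 * H 1F)     ≡⟨ double K (H 1F) ⟩
      K * (H 1F + H 1F)    ≡⟨ cong (λ h → K * (H 1F + h)) (sym (fused-symmetric H H-symmetric)) ⟩
      K * (H 1F + H 2F)    ≡⟨ balance ⟩
      + 2 * K              ≡⟨ ring K ⟩
      K * (+ 2 * 1ℤ)       ∎))
      where
      open ≡-Reasoning
      row-zero : - (+ 2 * K) + K * (H 1F + H 2F) ≡ 0ℤ
      row-zero = trans (cong (λ h → h + K * (H 1F + H 2F)) (sym H-o)) (trans (sym (fused-row H)) H-row)
      balance : K * (H 1F + H 2F) ≡ + 2 * K
      balance = trans (shift K (K * (H 1F + H 2F)))
                      (trans (cong (_+ + 2 * K) row-zero) (ℤP.+-identityˡ (+ 2 * K)))
        where
        shift : ∀ K x → x ≡ (- (+ 2 * K) + x) + + 2 * K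
        shift = solve-∀
      double : ∀ K h → K * (+ 2 * h) ≡ K * (h + h)
      double = solve-∀
      ring : ∀ K → + 2 * K ≡ K * (+ 2 * 1ℤ)
      ring = solve-∀

    square : ⟦ d ⟧ ⊗ ⟦ d ⟧ ≐ ⟦ (λ w → 1ℤ - N * δ o w) ⟧
    square x y = trans (square-fused x y) (value (c x y))
      where
      zero-term : ∀ {δw} → δw ≡ 0ℤ → 1ℤ - N * δw ≡ 1ℤ
      zero-term refl = cong (_-_ 1ℤ) (ℤP.*-zeroʳ N)
      value : ∀ w → H (g w) ≡ 1ℤ - N * δ o w
      value w with w ≟ᶜ o
      ... | yes refl = trans (cong H o-in-zero) (trans H-o (trans (ring K) (cong (λ n → 1ℤ - n * 1ℤ) (sym N-formula))))
        where
        ring : ∀ K → - (+ 2 * K) ≡ 1ℤ - (1ℤ + + 2 * K) * 1ℤ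
        ring = solve-∀
      ... | no w≢o with off-o w w≢o
      ...   | inj₁ (e , _) = trans (cong H e) (trans H-off (sym (zero-term (δo-off w w≢o))))
      ...   | inj₂ (e , _) = trans (cong H e) (trans (trans (fused-symmetric H H-symmetric) H-off) (sym (zero-term (δo-off w w≢o))))

    -- The number P of common successors in t and t̄ of adjacent points gives
    -- K = 1 + 2 P.
    P : Fin 3 → ℤ
    P k = + p 1F 2F k

    t-row : row t ≡ K
    t-row = trans (fused-row (λ i → χ ⌊ i ≟ 1F ⌋)) (ring K)
      where
      ring : ∀ K → 0ℤ + K * (1ℤ + 0ℤ) ≡ K
      ring = solve-∀

    t̄-row : row t̄ ≡ K
    t̄-row = trans (fused-row (λ i → χ ⌊ i ≟ 2F ⌋)) (ring K)
      where
      ring : ∀ K → 0ℤ + K * (0ℤ + 1ℤ) ≡ K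
      ring = solve-∀

    t-times-t̄ᵀ : ∀ w → t w * t̄ (w ᵀ) ≡ t w
    t-times-t̄ᵀ w = trans (cong (t w *_) (trans (t̄-ᵀ (w ᵀ)) (cong t (ᵀ-involutive w)))) (idempotent (g w))
      where
      idempotent : ∀ i → χ ⌊ i ≟ 1F ⌋ * χ ⌊ i ≟ 1F ⌋ ≡ χ ⌊ i ≟ 1F ⌋
      idempotent 0F = refl
      idempotent 1F = refl
      idempotent 2F = refl

    module Cross = Product t t̄ (P ∘ g) (part-product g G 1F 2F)

    P-o : P 0F ≡ K
    P-o = begin
      P 0F                       ≡⟨ cong P (sym o-in-zero) ⟩
      P (g o)                    ≡⟨ Cross.value-o ⟩
      row (λ w → t w * t̄ (w ᵀ))  ≡⟨ row-cong t-times-t̄ᵀ ⟩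
      row t                      ≡⟨ t-row ⟩
      K                          ∎
      where open ≡-Reasoning

    P-row : row (P ∘ g) ≡ K * K
    P-row = trans Cross.row-product (cong₂ _*_ t-row t̄-row)

    P-symmetric : ∀ x y → P (g (c x y)) ≡ P (g (c y x))
    P-symmetric = Cross.symmetric invariant
      where
      invariant : ∀ u v → t u * t̄ v ≡ t (v ᵀ) * t̄ (u ᵀ)
      invariant u v = begin
        t u * t̄ v               ≡⟨ ℤP.*-comm (t u) (t̄ v) ⟩
        t̄ v * t u               ≡⟨ cong₂ _*_ (t̄-ᵀ v) (cong t (sym (ᵀ-involutive u))) ⟩
        t (v ᵀ) * t (u ᵀ ᵀ)     ≡⟨ cong (t (v ᵀ) *_) (sym (t̄-ᵀ (u ᵀ))) ⟩
        t (v ᵀ) * t̄ (u ᵀ)       ∎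
        where open ≡-Reasoning

    odd : ∃ λ γ → K ≡ 1ℤ + + 2 * γ
    odd = P 1F , sym (cancel-positive K-positive (begin
      K * (1ℤ + + 2 * P 1F)        ≡⟨ ring K (P 1F) ⟩
      K + K * (P 1F + P 1F)        ≡⟨ cong₂ (λ u v → u + K * (P 1F + v)) (sym P-o) (sym (fused-symmetric P P-symmetric)) ⟩
      P 0F + K * (P 1F + P 2F)     ≡⟨ sym (fused-row P) ⟩
      row (P ∘ g)                  ≡⟨ P-row ⟩
      K * K                        ∎))
      where
      open ≡-Reasoning
      ring : ∀ K P → K * (1ℤ + + 2 * P) ≡ K + K * (P + P)
      ring = solve-∀

  module Tab  = Tournament tournament-ab  ab-admissible  (Admissible.transpose-parts ab-admissible)
  module Tab' = Tournament tournament-ab' ab'-admissible (Admissible.transpose-parts ab'-admissible)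

  dA dB : Class → ℤ
  dA w = part keep-a 1F w - part keep-a 2F w
  dB w = dA (swap w)

  squares : ⟦ dA ⟧ ⊗ ⟦ dA ⟧ ⊕ ⟦ dB ⟧ ⊗ ⟦ dB ⟧ ≐ ⟦ (λ w → 1ℤ - N * δ o w) ⟧
  squares x y = cancel-positive (1 , refl) (begin
    + 2 * (sum (λ z → dA (c x z) * dA (c z y)) + sum (λ z → dB (c x z) * dB (c z y)))
      ≡⟨ cong (+ 2 *_) (sym (∑-distrib-+ (λ z → dA (c x z) * dA (c z y)) (λ z → dB (c x z) * dB (c z y)))) ⟩
    + 2 * sum (λ z → dA (c x z) * dA (c z y) + dB (c x z) * dB (c z y))
      ≡⟨ *-distribˡ-sum (+ 2) (λ z → dA (c x z) * dA (c z y) + dB (c x z) * dB (c z y)) ⟩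
    sum (λ z → + 2 * (dA (c x z) * dA (c z y) + dB (c x z) * dB (c z y)))
      ≡⟨ sum-cong-≗ (λ z → split (c x z) (c z y)) ⟩
    sum (λ z → Tab.d (c x z) * Tab.d (c z y) + Tab'.d (c x z) * Tab'.d (c z y))
      ≡⟨ ∑-distrib-+ (λ z → Tab.d (c x z) * Tab.d (c z y)) (λ z → Tab'.d (c x z) * Tab'.d (c z y)) ⟩
    (⟦ Tab.d ⟧ ⊗ ⟦ Tab.d ⟧) x y + (⟦ Tab'.d ⟧ ⊗ ⟦ Tab'.d ⟧) x y
      ≡⟨ cong₂ _+_ (Tab.square x y) (Tab'.square x y) ⟩
    (1ℤ - N * δ o (c x y)) + (1ℤ - N * δ o (c x y))
      ≡⟨ double (1ℤ - N * δ o (c x y)) ⟩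
    + 2 * (1ℤ - N * δ o (c x y))      ∎)
    where
    open ≡-Reasoning
    -- dT = dA + dB and dU = dA − dB, so dT ⊗ dT + dU ⊗ dU = 2 (dA ⊗ dA + dB ⊗ dB).
    split : ∀ u v → + 2 * (dA u * dA v + dB u * dB v) ≡ Tab.d u * Tab.d v + Tab'.d u * Tab'.d v
    split = check₂ (λ u v → + 2 * (dA u * dA v + dB u * dB v) ℤP.≟ Tab.d u * Tab.d v + Tab'.d u * Tab'.d v)
    double : ∀ x → x + x ≡ + 2 * x
    double = solve-∀

  -- The pair a, a'.  With α, α' the indicators of a, a', s = α + α' and
  -- D = ⟦ dA ⟧, the matrix ⟦ s ⟧ has D as an eigenmatrix: ⟦ s ⟧ D = θ D.
  -- The point is that ⟦ α ⟧ and ⟦ α' ⟧ commute.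
  module PairA where
    open Fusion keep-a keep-a-admissible using (p)

    α α' s : Class → ℤ
    α  = part keep-a 1F
    α' = part keep-a 2F
    s w = α w + α' w

    P₁₁ P₁₂ P₂₁ : Class → ℤ
    P₁₁ w = + p 1F 1F (keep-a w)
    P₁₂ w = + p 1F 2F (keep-a w)
    P₂₁ w = + p 2F 1F (keep-a w)

    α'-ᵀ : ∀ w → α' w ≡ α (w ᵀ)
    α'-ᵀ = check (λ w → α' w ℤP.≟ α (w ᵀ))

    α'-transpose : ⟦ α' ⟧ ≐ λ x y → α (c y x)
    α'-transpose x y = trans (α'-ᵀ (c x y)) (cong α (sym (transposed x y)))

    α'α' : ∀ x y → (⟦ α' ⟧ ⊗ ⟦ α' ⟧) x y ≡ P₁₁ (c x y ᵀ)
    α'α' x y = begin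
      (⟦ α' ⟧ ⊗ ⟦ α' ⟧) x y                            ≡⟨ ⊗-congˡ ⟦ α' ⟧ (λ u v → α'-ᵀ (c u v)) x y ⟩
      (⟦ (λ w → α (w ᵀ)) ⟧ ⊗ ⟦ α' ⟧) x y                ≡⟨ ⊗-congʳ ⟦ (λ w → α (w ᵀ)) ⟧ (λ u v → α'-ᵀ (c u v)) x y ⟩
      (⟦ (λ w → α (w ᵀ)) ⟧ ⊗ ⟦ (λ w → α (w ᵀ)) ⟧) x y   ≡⟨ sym (product-transpose α α x y) ⟩
      (⟦ α ⟧ ⊗ ⟦ α ⟧) y x                              ≡⟨ part-product keep-a keep-a-admissible 1F 1F y x ⟩
      P₁₁ (c y x)                                      ≡⟨ cong P₁₁ (transposed x y) ⟩
      P₁₁ (c x y ᵀ)                                    ∎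
      where open ≡-Reasoning

    module A·A' = Product α α' P₁₂ (part-product keep-a keep-a-admissible 1F 2F)
    module A'·A = Product α' α P₂₁ (part-product keep-a keep-a-admissible 2F 1F)

    -- ⟦ α ⟧ and ⟦ α' ⟧ commute, i.e. P₁₂ = P₂₁, checked class by class.
    -- On the diagonal both products count the a-successors.
    commute-o : P₁₂ o ≡ P₂₁ o
    commute-o = trans A·A'.value-o (sym A'·A.value-o)

    -- On a, count transitive triangles.
    weighted-total : ∀ (h : Class → ℤ) → sum (λ x → sum (λ y → α (c x y) * h (c x y))) ≡ N * (k₁ * h a)
    weighted-total h = begin
      sum (λ x → sum (λ y → α (c x y) * h (c x y))) ≡⟨ sum-cong-≗ (λ x → row-sum (λ w → α w * h w) x) ⟩
      sum {suc m} (λ x → row (λ w → α w * h w))    ≡⟨ sum-const (suc m) (row (λ w → α w * h w)) ⟩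
      N * row (λ w → α w * h w)                    ≡⟨ cong (N *_) (ring (h o) (h a) (h a') (h b) (h b') k₁ k₂) ⟩
      N * (k₁ * h a)                               ∎
      where
      open ≡-Reasoning
      ring : ∀ ho ha ha′ hb hb′ k₁ k₂ →
        0ℤ * ho + k₁ * (1ℤ * ha + 0ℤ * ha′) + k₂ * (0ℤ * hb + 0ℤ * hb′) ≡ k₁ * ha
      ring = solve-∀

    commute-a : P₁₂ a ≡ P₂₁ a
    commute-a = cancel-positive k₁-positive (cancel-positive (m , refl) (begin
      N * (k₁ * P₁₂ a)                                               ≡⟨ sym (weighted-total P₁₂) ⟩
      sum (λ x → sum (λ y → α (c x y) * P₁₂ (c x y)))                ≡⟨ sum-cong-≗ (λ x → sum-cong-≗ (λ y → cong (α (c x y) *_) (sym (A·Aᵀ x y)))) ⟩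
      sum (λ x → sum (λ y → ⟦ α ⟧ x y * (⟦ α ⟧ ⊗ Aᵀ) x y))           ≡⟨ transitive-triangles ⟦ α ⟧ ⟩
      sum (λ x → sum (λ y → ⟦ α ⟧ x y * (Aᵀ ⊗ ⟦ α ⟧) x y))           ≡⟨ sum-cong-≗ (λ x → sum-cong-≗ (λ y → cong (α (c x y) *_) (Aᵀ·A x y))) ⟩
      sum (λ x → sum (λ y → α (c x y) * P₂₁ (c x y)))                ≡⟨ weighted-total P₂₁ ⟩
      N * (k₁ * P₂₁ a)                                               ∎))
      where
      open ≡-Reasoning
      Aᵀ : Mat (suc m)
      Aᵀ x y = α (c y x)
      A·Aᵀ : ⟦ α ⟧ ⊗ Aᵀ ≐ ⟦ P₁₂ ⟧
      A·Aᵀ x y = trans (⊗-congʳ ⟦ α ⟧ (λ u v → sym (α'-transpose u v)) x y)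
                       (part-product keep-a keep-a-admissible 1F 2F x y)
      Aᵀ·A : Aᵀ ⊗ ⟦ α ⟧ ≐ ⟦ P₂₁ ⟧
      Aᵀ·A x y = trans (⊗-congˡ ⟦ α ⟧ (λ u v → sym (α'-transpose u v)) x y)
                       (part-product keep-a keep-a-admissible 2F 1F x y)

    -- On a', both products are symmetric.
    commute-a' : P₁₂ a' ≡ P₂₁ a'
    commute-a' = begin
      P₁₂ a'  ≡⟨ symmetric-balanced P₁₂ (A·A'.symmetric (check₂ (λ u v → α u * α' v ℤP.≟ α (v ᵀ) * α' (u ᵀ)))) ⟩
      P₁₂ a   ≡⟨ commute-a ⟩
      P₂₁ a   ≡⟨ sym (symmetric-balanced P₂₁ (A'·A.symmetric (check₂ (λ u v → α' u * α v ℤP.≟ α' (v ᵀ) * α (u ᵀ))))) ⟩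
      P₂₁ a'  ∎
      where open ≡-Reasoning

    -- On b and b', compare the row sums, both equal to k₁².
    commute-b : P₁₂ b ≡ P₂₁ b
    commute-b = cancel-positive (1 , refl) (cancel-positive k₂-positive (begin
      k₂ * (+ 2 * P₁₂ b)                           ≡⟨ ring (P₁₂ o) (P₁₂ a) (P₁₂ a') (P₁₂ b) ⟩
      row P₁₂ - (P₁₂ o + k₁ * (P₁₂ a + P₁₂ a'))    ≡⟨ cong₂ _-_ rows rest ⟩
      row P₂₁ - (P₂₁ o + k₁ * (P₂₁ a + P₂₁ a'))    ≡⟨ sym (ring (P₂₁ o) (P₂₁ a) (P₂₁ a') (P₂₁ b)) ⟩
      k₂ * (+ 2 * P₂₁ b)                           ∎))
      where
      open ≡-Reasoning
      rows : row P₁₂ ≡ row P₂₁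
      rows = trans A·A'.row-product (trans (ℤP.*-comm (row α) (row α')) (sym A'·A.row-product))
      rest : P₁₂ o + k₁ * (P₁₂ a + P₁₂ a') ≡ P₂₁ o + k₁ * (P₂₁ a + P₂₁ a')
      rest = cong₂ _+_ commute-o (cong (k₁ *_) (cong₂ _+_ commute-a commute-a'))
      ring : ∀ Po Pa Pa′ Pb → k₂ * (+ 2 * Pb) ≡ (Po + k₁ * (Pa + Pa′) + k₂ * (Pb + Pb)) - (Po + k₁ * (Pa + Pa′))
      ring Po Pa Pa′ Pb = ring′ Po Pa Pa′ Pb k₁ k₂
        where
        ring′ : ∀ Po Pa Pa′ Pb k₁ k₂ → k₂ * (+ 2 * Pb) ≡ (Po + k₁ * (Pa + Pa′) + k₂ * (Pb + Pb)) - (Po + k₁ * (Pa + Pa′))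
        ring′ = solve-∀

    commute : ∀ w → P₁₂ w ≡ P₂₁ w
    commute o  = commute-o
    commute a  = commute-a
    commute a' = commute-a'
    commute b  = commute-b
    commute b' = commute-b

    -- ⟦ s ⟧ ⟦ dA ⟧ = (⟦ α ⟧² − ⟦ α' ⟧²) + (⟦ α' ⟧ ⟦ α ⟧ − ⟦ α ⟧ ⟦ α' ⟧), and the
    -- commutator vanishes; ⟦ α' ⟧² is the transpose of ⟦ α ⟧².
    eigenvalue : ℤ
    eigenvalue = P₁₁ a - P₁₁ a'

    expand : (⟦ α ⟧ ⊕ ⟦ α' ⟧) ⊗ (⟦ α ⟧ ⊖ ⟦ α' ⟧) ≐
             ⟦ α ⟧ ⊗ ⟦ α ⟧ ⊖ ⟦ α ⟧ ⊗ ⟦ α' ⟧ ⊕ (⟦ α' ⟧ ⊗ ⟦ α ⟧ ⊖ ⟦ α' ⟧ ⊗ ⟦ α' ⟧)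
    expand = begin
      (⟦ α ⟧ ⊕ ⟦ α' ⟧) ⊗ (⟦ α ⟧ ⊖ ⟦ α' ⟧)
        ≈⟨ ⊗-distribʳ-⊕ ⟦ α ⟧ ⟦ α' ⟧ (⟦ α ⟧ ⊖ ⟦ α' ⟧) ⟩
      ⟦ α ⟧ ⊗ (⟦ α ⟧ ⊖ ⟦ α' ⟧) ⊕ ⟦ α' ⟧ ⊗ (⟦ α ⟧ ⊖ ⟦ α' ⟧)
        ≈⟨ ⊕-cong (⊗-distribˡ-⊖ ⟦ α ⟧ ⟦ α ⟧ ⟦ α' ⟧) (⊗-distribˡ-⊖ ⟦ α' ⟧ ⟦ α ⟧ ⟦ α' ⟧) ⟩
      ⟦ α ⟧ ⊗ ⟦ α ⟧ ⊖ ⟦ α ⟧ ⊗ ⟦ α' ⟧ ⊕ (⟦ α' ⟧ ⊗ ⟦ α ⟧ ⊖ ⟦ α' ⟧ ⊗ ⟦ α' ⟧) ∎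
      where open ≐-Reasoning

    eigen : ⟦ s ⟧ ⊗ ⟦ dA ⟧ ≐ eigenvalue ⊙ ⟦ dA ⟧
    eigen x y = begin
      ((⟦ α ⟧ ⊕ ⟦ α' ⟧) ⊗ (⟦ α ⟧ ⊖ ⟦ α' ⟧)) x y
        ≡⟨ expand x y ⟩
      (⟦ α ⟧ ⊗ ⟦ α ⟧ ⊖ ⟦ α ⟧ ⊗ ⟦ α' ⟧ ⊕ (⟦ α' ⟧ ⊗ ⟦ α ⟧ ⊖ ⟦ α' ⟧ ⊗ ⟦ α' ⟧)) x y
        ≡⟨ cong₂ _+_ (cong₂ _-_ (part-product keep-a keep-a-admissible 1F 1F x y) (part-product keep-a keep-a-admissible 1F 2F x y))
                     (cong₂ _-_ (part-product keep-a keep-a-admissible 2F 1F x y) (α'α' x y)) ⟩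
      (P₁₁ (c x y) - P₁₂ (c x y)) + (P₂₁ (c x y) - P₁₁ (c x y ᵀ))
        ≡⟨ cong (λ u → (P₁₁ (c x y) - P₁₂ (c x y)) + (u - P₁₁ (c x y ᵀ))) (sym (commute (c x y))) ⟩
      (P₁₁ (c x y) - P₁₂ (c x y)) + (P₁₂ (c x y) - P₁₁ (c x y ᵀ))
        ≡⟨ telescope (c x y) ⟩
      eigenvalue * dA (c x y)           ∎
      where
      open ≡-Reasoning
      vanish : ∀ x y k → (x - y) + (y - x) ≡ k * 0ℤ
      vanish = solve-∀
      plus : ∀ A B y → (A - y) + (y - B) ≡ (A - B) * 1ℤ
      plus = solve-∀
      minus : ∀ A B y → (B - y) + (y - A) ≡ (A - B) * -1ℤ
      minus = solve-∀
      telescope : ∀ w → (P₁₁ w - P₁₂ w) + (P₁₂ w - P₁₁ (w ᵀ)) ≡ eigenvalue * dA w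
      telescope o  = vanish (P₁₁ o) (P₁₂ o) eigenvalue
      telescope a  = plus (P₁₁ a) (P₁₁ a') (P₁₂ a)
      telescope a' = minus (P₁₁ a) (P₁₁ a') (P₁₂ a')
      telescope b  = vanish (P₁₁ b) (P₁₂ b) eigenvalue
      telescope b' = vanish (P₁₁ b) (P₁₂ b) eigenvalue

-- Arithmetic of the valencies

parity : ∀ x → ∃ λ y → x ≡ + 2 * y ⊎ x ≡ 1ℤ + + 2 * y
parity x with x %ℕ 2 | n%ℕd<d x 2 | a≡a%ℕn+[a/ℕn]*n x 2
... | 0           | _              | x≡ = x /ℕ 2 , inj₁ (trans x≡ (ring (x /ℕ 2)))
  where
  ring : ∀ q → + 0 + q * + 2 ≡ + 2 * q
  ring = solve-∀
... | 1           | _              | x≡ = x /ℕ 2 , inj₂ (trans x≡ (ring (x /ℕ 2)))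
  where
  ring : ∀ q → + 1 + q * + 2 ≡ 1ℤ + + 2 * q
  ring = solve-∀
... | suc (suc _) | s≤s (s≤s ())   | _

odd≢even : ∀ x y → 1ℤ + + 2 * x ≢ + 2 * y
odd≢even x y eq with ℕP.m*n≡1⇒m≡1 2 ∣ y - x ∣ (sym (trans (cong ∣_∣ one≡) (ℤP.abs-* (+ 2) (y - x))))
  where
  one≡ : 1ℤ ≡ + 2 * (y - x)
  one≡ = trans (ring₁ x) (trans (cong (_- (+ 2 * x)) eq) (ring₂ x y))
    where
    ring₁ : ∀ x → 1ℤ ≡ (1ℤ + + 2 * x) - + 2 * x
    ring₁ = solve-∀
    ring₂ : ∀ x y → + 2 * y - + 2 * x ≡ + 2 * (y - x)
    ring₂ = solve-∀
... | ()

odd≢even+even : ∀ {x y} → (∃ λ γ → x + y ≡ 1ℤ + + 2 * γ) → (∃ λ β → x ≡ + 2 * β) → (∃ λ β → y ≡ + 2 * β) → ⊥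
odd≢even+even {x} {y} (γ , x+y-odd) (β₁ , x-even) (β₂ , y-even) = odd≢even γ (β₁ + β₂) (begin
  1ℤ + + 2 * γ           ≡⟨ sym x+y-odd ⟩
  x + y                  ≡⟨ cong₂ _+_ x-even y-even ⟩
  + 2 * β₁ + + 2 * β₂    ≡⟨ sym (ℤP.*-distribˡ-+ (+ 2) β₁ β₂) ⟩
  + 2 * (β₁ + β₂)        ∎)
  where open ≡-Reasoning

-- The quantity forced to vanish by the two eigenvalue equations.
Δ : ℤ → ℤ → ℤ → ℤ
Δ k₁ k₂ θ = (k₂ * (1ℤ + + 2 * k₂) - θ * θ * k₂) - k₁ * (1ℤ + θ) * (1ℤ + θ)

-- Eliminating μ from the equations  θ D + μ E = 2k₁  and
-- θ² D + μ² E = (2k₁)² − 2N k₁, where D = −2k₁, E = −2k₂, N = 1 + 2(k₁ + k₂).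
eliminate : ∀ k₁ k₂ θ μ N →
  θ * - (+ 2 * k₁) + μ * - (+ 2 * k₂) ≡ + 2 * k₁ →
  θ * θ * - (+ 2 * k₁) + μ * μ * - (+ 2 * k₂) ≡ + 2 * k₁ * (+ 2 * k₁) - N * (+ 2 * k₁) →
  N ≡ 1ℤ + + 2 * (k₁ + k₂) → + 2 * k₁ * Δ k₁ k₂ θ ≡ 0ℤ
eliminate k₁ k₂ θ μ N linear quadratic refl = begin
  + 2 * k₁ * Δ k₁ k₂ θ  ≡⟨ ring k₁ k₂ θ μ ⟩
  k₂ * (Q - Q′) - (μ * k₂ - k₁ * (1ℤ + θ)) * (L - L′)
    ≡⟨ cong₂ (λ u v → k₂ * u - (μ * k₂ - k₁ * (1ℤ + θ)) * v) (ℤP.i≡j⇒i-j≡0 quadratic) (ℤP.i≡j⇒i-j≡0 linear) ⟩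
  k₂ * 0ℤ - (μ * k₂ - k₁ * (1ℤ + θ)) * 0ℤ ≡⟨ ring₀ k₂ (μ * k₂ - k₁ * (1ℤ + θ)) ⟩
  0ℤ                    ∎
  where
  open ≡-Reasoning
  L L′ Q Q′ : ℤ
  L  = θ * - (+ 2 * k₁) + μ * - (+ 2 * k₂)
  L′ = + 2 * k₁
  Q  = θ * θ * - (+ 2 * k₁) + μ * μ * - (+ 2 * k₂)
  Q′ = + 2 * k₁ * (+ 2 * k₁) - (1ℤ + + 2 * (k₁ + k₂)) * (+ 2 * k₁)
  ring : ∀ x y t u → + 2 * x * ((y * (1ℤ + + 2 * y) - t * t * y) - x * (1ℤ + t) * (1ℤ + t)) ≡
    y * ((t * t * - (+ 2 * x) + u * u * - (+ 2 * y)) - (+ 2 * x * (+ 2 * x) - (1ℤ + + 2 * (x + y)) * (+ 2 * x)))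
    - (u * y - x * (1ℤ + t)) * ((t * - (+ 2 * x) + u * - (+ 2 * y)) - + 2 * x)
  ring = solve-∀
  ring₀ : ∀ x y → x * 0ℤ - y * 0ℤ ≡ 0ℤ
  ring₀ = solve-∀

-- When k₂ is odd and k₁ = (1 + 2γ) − k₂ is even, Δ does not vanish:
-- it is odd if θ is even, and twice an odd number if θ is odd.
Δ-nonzero : ∀ γ β θ → Δ ((1ℤ + + 2 * γ) - (1ℤ + + 2 * β)) (1ℤ + + 2 * β) θ ≢ 0ℤ
Δ-nonzero γ β θ Δ≡0 with parity θ
... | s , inj₁ refl = odd≢even (Y γ β s) 0ℤ (trans (ring γ β s) Δ≡0)
  where
  Y : ℤ → ℤ → ℤ → ℤ
  Y γ β s = 1ℤ + + 5 * β + + 4 * β * β - + 2 * s * s * (1ℤ + + 2 * β) - (γ - β) * (1ℤ + + 2 * s) * (1ℤ + + 2 * s)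
  ring : ∀ γ β s → 1ℤ + + 2 * (1ℤ + + 5 * β + + 4 * β * β - + 2 * s * s * (1ℤ + + 2 * β) - (γ - β) * (1ℤ + + 2 * s) * (1ℤ + + 2 * s)) ≡
    ((1ℤ + + 2 * β) * (1ℤ + + 2 * (1ℤ + + 2 * β)) - + 2 * s * (+ 2 * s) * (1ℤ + + 2 * β))
      - ((1ℤ + + 2 * γ) - (1ℤ + + 2 * β)) * (1ℤ + + 2 * s) * (1ℤ + + 2 * s)
  ring = solve-∀
... | s , inj₂ refl = odd≢even (Y γ β s) 0ℤ (ℤP.*-cancelˡ-≡ (+ 2) _ _ (trans (ring γ β s) Δ≡0))
  where
  Y : ℤ → ℤ → ℤ → ℤ
  Y γ β s = + 2 * β + + 2 * β * β - (1ℤ + + 2 * β) * (s + s * s) - + 2 * (γ - β) * (1ℤ + s) * (1ℤ + s)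
  ring : ∀ γ β s → + 2 * (1ℤ + + 2 * (+ 2 * β + + 2 * β * β - (1ℤ + + 2 * β) * (s + s * s) - + 2 * (γ - β) * (1ℤ + s) * (1ℤ + s))) ≡
    ((1ℤ + + 2 * β) * (1ℤ + + 2 * (1ℤ + + 2 * β)) - (1ℤ + + 2 * s) * (1ℤ + + 2 * s) * (1ℤ + + 2 * β))
      - ((1ℤ + + 2 * γ) - (1ℤ + + 2 * β)) * (1ℤ + (1ℤ + + 2 * s)) * (1ℤ + (1ℤ + + 2 * s))
  ring = solve-∀

Δ-parity : ∀ k₁ k₂ θ γ → k₁ + k₂ ≡ 1ℤ + + 2 * γ → Δ k₁ k₂ θ ≡ 0ℤ → ∃ λ β → k₂ ≡ + 2 * β
Δ-parity k₁ k₂ θ γ k-odd Δ≡0 with parity k₂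
... | β , inj₁ k₂-even = β , k₂-even
... | β , inj₂ refl = ⊥-elim (Δ-nonzero γ β θ (trans (cong (λ k → Δ k (1ℤ + + 2 * β) θ) (sym k₁≡)) Δ≡0))
  where
  k₁≡ : k₁ ≡ (1ℤ + + 2 * γ) - (1ℤ + + 2 * β)
  k₁≡ = trans (ring k₁ (1ℤ + + 2 * β)) (cong (_- (1ℤ + + 2 * β)) k-odd)
    where
    ring : ∀ x y → x ≡ (x + y) - y
    ring = solve-∀

-- Evaluating X (D² + E²) and X² (D² + E²) at a diagonal entry gives two
-- equations which force k₂ to be even.
module Eigenvalues {m} {c : Fin (suc m) → Fin (suc m) → Class} (A : SkewAmorphous c) where
  open Labelled A
  open PairA using (s; eigen) renaming (eigenvalue to θ)
  module Sw = Labelled (swapped A)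

  J I X D E S₂ : Mat (suc m)
  J  = ⟦ (λ _ → 1ℤ) ⟧
  I  = ⟦ δ o ⟧
  X  = ⟦ s ⟧
  D  = ⟦ dA ⟧
  E  = ⟦ dB ⟧
  S₂ = ⟦ s ∘ swap ⟧

  -- In the swapped scheme the pair b, b' plays the role of a, a': S₂ E = q E.
  q μ : ℤ
  q = Sw.PairA.eigenvalue
  μ = - (1ℤ + q)

  -- Since X = J − I − S₂ and E has column sums 0, X E = −(1 + q) E.
  eigen-E : X ⊗ E ≐ μ ⊙ E
  eigen-E x y = begin
    (X ⊗ E) x y                                    ≡⟨ ⊗-congˡ E (λ u v → complement (c u v)) x y ⟩
    ((J ⊖ I ⊖ S₂) ⊗ E) x y                         ≡⟨ ⊗-distribʳ-⊖ (J ⊖ I) S₂ E x y ⟩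
    ((J ⊖ I) ⊗ E) x y - (S₂ ⊗ E) x y               ≡⟨ cong₂ _-_ (⊗-distribʳ-⊖ J I E x y) (Sw.PairA.eigen x y) ⟩
    ((J ⊗ E) x y - (I ⊗ E) x y) - q * dB (c x y)   ≡⟨ cong (_- q * dB (c x y)) (cong₂ _-_ column-zero (identity-left E x y)) ⟩
    (0ℤ - dB (c x y)) - q * dB (c x y)             ≡⟨ ring q (dB (c x y)) ⟩
    μ * dB (c x y)                                 ∎
    where
    open ≡-Reasoning
    complement : ∀ w → s w ≡ 1ℤ - δ o w - s (swap w)
    complement = check (λ w → s w ℤP.≟ 1ℤ - δ o w - s (swap w))
    column-zero : (J ⊗ E) x y ≡ 0ℤ
    column-zero = begin
      sum (λ z → 1ℤ * dB (c z y))   ≡⟨ sum-cong-≗ (λ z → ℤP.*-identityˡ (dB (c z y))) ⟩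
      sum (λ z → dB (c z y))        ≡⟨ column-sum dB y ⟩
      row (λ w → dB (w ᵀ))          ≡⟨ row-odd (λ w → dB (w ᵀ)) refl (check (λ w → dB (w ᵀ ᵀ) ℤP.≟ - dB (w ᵀ))) ⟩
      0ℤ                            ∎
    ring : ∀ q x → (0ℤ - x) - q * x ≡ - (1ℤ + q) * x
    ring = solve-∀

  D²-o : (D ⊗ D) zero zero ≡ - (+ 2 * k₁)
  D²-o = trans (diagonal-product dA dA zero) (ring k₁ k₂)
    where
    ring : ∀ k₁ k₂ → 0ℤ + k₁ * (1ℤ * -1ℤ + -1ℤ * 1ℤ) + k₂ * (0ℤ + 0ℤ) ≡ - (+ 2 * k₁)
    ring = solve-∀

  E²-o : (E ⊗ E) zero zero ≡ - (+ 2 * k₂)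
  E²-o = trans (diagonal-product dB dB zero) (ring k₁ k₂)
    where
    ring : ∀ k₁ k₂ → 0ℤ + k₁ * (0ℤ + 0ℤ) + k₂ * (1ℤ * -1ℤ + -1ℤ * 1ℤ) ≡ - (+ 2 * k₂)
    ring = solve-∀

  two-k₁ : ∀ k₁ k₂ → 0ℤ + k₁ * (1ℤ + 1ℤ) + k₂ * (0ℤ + 0ℤ) ≡ + 2 * k₁
  two-k₁ = solve-∀

  JN : Mat (suc m)
  JN = ⟦ (λ w → 1ℤ - N * δ o w) ⟧

  linear : θ * - (+ 2 * k₁) + μ * - (+ 2 * k₂) ≡ + 2 * k₁
  linear = begin
    θ * - (+ 2 * k₁) + μ * - (+ 2 * k₂)          ≡⟨ sym (cong₂ _+_ (cong (θ *_) D²-o) (cong (μ *_) E²-o)) ⟩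
    (θ ⊙ (D ⊗ D) ⊕ μ ⊙ (E ⊗ E)) zero zero        ≡⟨ sym (eigen-squares X D E θ μ eigen eigen-E zero zero) ⟩
    (X ⊗ (D ⊗ D ⊕ E ⊗ E)) zero zero              ≡⟨ ⊗-congʳ X squares zero zero ⟩
    (X ⊗ JN) zero zero                           ≡⟨ diagonal-product s (λ w → 1ℤ - N * δ o w) zero ⟩
    row (λ w → s w * (1ℤ - N * δ o (w ᵀ)))       ≡⟨ ring k₁ k₂ N ⟩
    + 2 * k₁                                     ∎
    where
    open ≡-Reasoning
    ring : ∀ k₁ k₂ N → 0ℤ * (1ℤ - N * 1ℤ) + k₁ * (1ℤ * (1ℤ - N * 0ℤ) + 1ℤ * (1ℤ - N * 0ℤ))
                       + k₂ * (0ℤ * (1ℤ - N * 0ℤ) + 0ℤ * (1ℤ - N * 0ℤ)) ≡ + 2 * k₁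
    ring = solve-∀

  quadratic : θ * θ * - (+ 2 * k₁) + μ * μ * - (+ 2 * k₂) ≡ + 2 * k₁ * (+ 2 * k₁) - N * (+ 2 * k₁)
  quadratic = begin
    θ * θ * - (+ 2 * k₁) + μ * μ * - (+ 2 * k₂)
      ≡⟨ sym (cong₂ _+_ (cong (θ * θ *_) D²-o) (cong (μ * μ *_) E²-o)) ⟩
    ((θ * θ) ⊙ (D ⊗ D) ⊕ (μ * μ) ⊙ (E ⊗ E)) zero zero
      ≡⟨ sym (eigen-squares (X ⊗ X) D E (θ * θ) (μ * μ) (eigen-square X D θ eigen) (eigen-square X E μ eigen-E) zero zero) ⟩
    (X ⊗ X ⊗ (D ⊗ D ⊕ E ⊗ E)) zero zero
      ≡⟨ ⊗-congʳ (X ⊗ X) squares zero zero ⟩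
    sum (λ z → (X ⊗ X) zero z * (1ℤ - N * δ o (c z zero)))
      ≡⟨ sum-cong-≗ (λ z → ring₁ ((X ⊗ X) zero z) (δ o (c z zero))) ⟩
    sum (λ z → (X ⊗ X) zero z - N * ((X ⊗ X) zero z * δ o (c z zero)))
      ≡⟨ sum-sub (λ z → (X ⊗ X) zero z) (λ z → N * ((X ⊗ X) zero z * δ o (c z zero))) ⟩
    sum (λ z → (X ⊗ X) zero z) - sum (λ z → N * ((X ⊗ X) zero z * δ o (c z zero)))
      ≡⟨ cong₂ _-_ (row-sum-product s s zero) (sym (*-distribˡ-sum N (λ z → (X ⊗ X) zero z * δ o (c z zero)))) ⟩
    row s * row s - N * (X ⊗ X ⊗ I) zero zero
      ≡⟨ cong (λ u → row s * row s - N * u) (trans (identity-right (X ⊗ X) zero zero) (diagonal-product s s zero)) ⟩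
    row s * row s - N * row (λ w → s w * s (w ᵀ))
      ≡⟨ cong₂ (λ u v → u * u - N * v) (two-k₁ k₁ k₂) (two-k₁ k₁ k₂) ⟩
    + 2 * k₁ * (+ 2 * k₁) - N * (+ 2 * k₁) ∎
    where
    open ≡-Reasoning
    ring₁ : ∀ x δ → x * (1ℤ - N * δ) ≡ x - N * (x * δ)
    ring₁ x δ = ring x δ N
      where
      ring : ∀ x δ N → x * (1ℤ - N * δ) ≡ x - N * (x * δ)
      ring = solve-∀

  k₂-even : ∃ λ β → k₂ ≡ + 2 * β
  k₂-even =
    let (γ , K-odd) = Tab.odd
        (j , k₁≡) = k₁-positive
    in Δ-parity k₁ k₂ θ γ K-odd
         (cancel-positive (_ , cong (+ 2 *_) k₁≡)
           (trans (eliminate k₁ k₂ θ μ N linear quadratic N-formula) (sym (ℤP.*-zeroʳ (+ 2 * k₁)))))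

swapped-k₂ : ∀ {m} {c : Fin (suc m) → Fin (suc m) → Class} (A : SkewAmorphous c) →
  Labelled.k₂ (swapped A) ≡ Labelled.k₁ A
swapped-k₂ {c = c} A = cong +_ (begin
  Sw.valency b                                ≡⟨ sym (Sw.Singletons.row-count 3F zero) ⟩
  count (λ z → ⌊ code (swap (c zero z)) ≟ 3F ⌋) ≡⟨ count-cong (λ z → same (c zero z)) ⟩
  count (λ z → ⌊ code (c zero z) ≟ 1F ⌋)        ≡⟨ L.Singletons.row-count 1F zero ⟩
  L.valency a                                 ∎)
  where
  open ≡-Reasoning
  module L  = Labelled A
  module Sw = Labelled (swapped A)
  same : ∀ w → ⌊ code (swap w) ≟ 3F ⌋ ≡ ⌊ code w ≟ 1F ⌋
  same = check (λ w → ⌊ code (swap w) ≟ 3F ⌋ Bool.≟ ⌊ code w ≟ 1F ⌋)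

-- The labelled form of the theorem: k₁ and k₂ are both even (apply the
-- eigenvalue argument to the scheme and to its swap), but k₁ + k₂ is odd.
no-skew-amorphous : ∀ {m} {c : Fin (suc m) → Fin (suc m) → Class} → SkewAmorphous c → ⊥
no-skew-amorphous A =
  odd≢even+even (Labelled.Tab.odd A)
                (map₂ (trans (sym (swapped-k₂ A))) (Eigenvalues.k₂-even (swapped A)))
                (Eigenvalues.k₂-even A)

-- From a skew-symmetric 4-class scheme to its labelled form

σ₁ σ₂ σ₃ : Fin 5 → Fin 5
σ₁ 0F = 0F
σ₁ 1F = 2F
σ₁ 2F = 1F
σ₁ 3F = 4F
σ₁ 4F = 3F
σ₂ 0F = 0F
σ₂ 1F = 3F
σ₂ 2F = 4F
σ₂ 3F = 1F
σ₂ 4F = 2F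
σ₃ 0F = 0F
σ₃ 1F = 4F
σ₃ 2F = 3F
σ₃ 3F = 2F
σ₃ 4F = 1F

module Involution (t : Fin 5 → Fin 5) (t0 : t 0F ≡ 0F) (involutive : ∀ i → t (t i) ≡ i)
                  (fixed : ∀ i → t i ≡ i → i ≡ 0F) where

  injective : ∀ {i j} → t i ≡ t j → i ≡ j
  injective {i} {j} e = trans (sym (involutive i)) (trans (cong t e) (involutive j))

  partner : ∀ {i j} → t i ≡ j → t j ≡ i
  partner {i} e = trans (cong t (sym e)) (involutive i)

  cases : (∀ i → t i ≡ σ₁ i) ⊎ (∀ i → t i ≡ σ₂ i) ⊎ (∀ i → t i ≡ σ₃ i)
  cases with t 1F in e₁
  ... | 0F = contradiction (injective (trans e₁ (sym t0))) λ ()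
  ... | 1F = contradiction (fixed 1F e₁) λ ()
  ... | 2F with t 3F in e₃
  ...   | 0F = contradiction (injective (trans e₃ (sym t0))) λ ()
  ...   | 1F = contradiction (injective (trans e₃ (sym (partner e₁)))) λ ()
  ...   | 2F = contradiction (injective (trans e₃ (sym e₁))) λ ()
  ...   | 3F = contradiction (fixed 3F e₃) λ ()
  ...   | 4F = inj₁ λ { 0F → t0 ; 1F → e₁ ; 2F → partner e₁ ; 3F → e₃ ; 4F → partner e₃ }
  cases | 3F with t 2F in e₂
  ...   | 0F = contradiction (injective (trans e₂ (sym t0))) λ ()
  ...   | 1F = contradiction (injective (trans e₂ (sym (partner e₁)))) λ ()
  ...   | 2F = contradiction (fixed 2F e₂) λ ()
  ...   | 3F = contradiction (injective (trans e₂ (sym e₁))) λ ()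
  ...   | 4F = inj₂ (inj₁ λ { 0F → t0 ; 1F → e₁ ; 2F → e₂ ; 3F → partner e₁ ; 4F → partner e₂ })
  cases | 4F with t 2F in e₂
  ...   | 0F = contradiction (injective (trans e₂ (sym t0))) λ ()
  ...   | 1F = contradiction (injective (trans e₂ (sym (partner e₁)))) λ ()
  ...   | 2F = contradiction (fixed 2F e₂) λ ()
  ...   | 3F = inj₂ (inj₂ λ { 0F → t0 ; 1F → e₁ ; 2F → e₂ ; 3F → partner e₂ ; 4F → partner e₁ })
  ...   | 4F = contradiction (injective (trans e₂ (sym e₁))) λ ()

record Labelling (t : Fin 5 → Fin 5) : Set where
  field
    label       : Fin 5 → Class
    index       : Class → Fin 5
    label-index : ∀ w → label (index w) ≡ w
    index-label : ∀ i → index (label i) ≡ i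
    label-zero  : label 0F ≡ o
    label-t     : ∀ i → label (t i) ≡ label i ᵀ

labelling : (σ π π⁻¹ : Fin 5 → Fin 5) →
  {True (all-classes? (λ w → decode (π (π⁻¹ (code w))) ≟ᶜ w))} →
  {True (all? (λ i → π⁻¹ (code (decode (π i))) ≟ i))} →
  {True (decode (π 0F) ≟ᶜ o)} →
  {True (all? (λ i → decode (π (σ i)) ≟ᶜ decode (π i) ᵀ))} → Labelling σ
labelling σ π π⁻¹ {label-index} {index-label} {label-zero} {label-σ} = record
  { label       = decode ∘ π
  ; index       = π⁻¹ ∘ code
  ; label-index = toWitness label-index
  ; index-label = toWitness index-label
  ; label-zero  = toWitness label-zero
  ; label-t     = toWitness label-σ
  }

relabel : ∀ {σ t} → Labelling σ → (∀ i → t i ≡ σ i) → Labelling t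
relabel L t≗σ = record
  { label = label ; index = index ; label-index = label-index ; index-label = index-label
  ; label-zero = label-zero ; label-t = λ i → trans (cong label (t≗σ i)) (label-t i) }
  where open Labelling L

-- The permutations of {1, 2, 3, 4} sending the pairs of σ₂ and σ₃ to those of σ₁.
π₂ π₃ π₃⁻¹ : Fin 5 → Fin 5
π₂ 0F = 0F
π₂ 1F = 1F
π₂ 2F = 3F
π₂ 3F = 2F
π₂ 4F = 4F
π₃ 0F = 0F
π₃ 1F = 1F
π₃ 2F = 3F
π₃ 3F = 4F
π₃ 4F = 2F
π₃⁻¹ 0F = 0F
π₃⁻¹ 1F = 1F
π₃⁻¹ 2F = 4F
π₃⁻¹ 3F = 2F
π₃⁻¹ 4F = 3F

labelling-of : ∀ {m} {r : Fin (suc m) → Fin (suc m) → Fin 5} (S : IsAssocScheme r) → SkewSymmetric r →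
  Labelling (IsAssocScheme.tr S)
labelling-of S skew with Involution.cases (IsAssocScheme.tr S) tr-zero tr-involutive (tr-fixed skew)
  where open Transposition S
... | inj₁ t≗σ₁        = relabel (labelling σ₁ (λ i → i) (λ i → i)) t≗σ₁
... | inj₂ (inj₁ t≗σ₂) = relabel (labelling σ₂ π₂ π₂) t≗σ₂
... | inj₂ (inj₂ t≗σ₃) = relabel (labelling σ₃ π₃ π₃⁻¹) t≗σ₃

module FromScheme {m} {r : Fin (suc m) → Fin (suc m) → Fin 5} (S : IsAssocScheme r)
                  (L : Labelling (IsAssocScheme.tr S)) (amorphous : Amorphous S) where
  open IsAssocScheme S
  open Transposition S using (tr-flip; tr-involutive)
  open Labelling L

  c : Fin (suc m) → Fin (suc m) → Class
  c x y = label (r x y)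

  index-o : index o ≡ 0F
  index-o = trans (cong index (sym label-zero)) (index-label 0F)

  label-o : ∀ {i} → label i ≡ o → i ≡ 0F
  label-o {i} e = trans (sym (index-label i)) (trans (cong index e) index-o)

  admissible-indices : ∀ {e} {g : Class → Fin (suc e)} → Admissible g → IsAdmissible S (g ∘ label)
  admissible-indices {g = g} G = record
    { parts-nonempty = λ j → let (w , gw≡j) = part-nonempty j in index w , trans (cong g (label-index w)) gw≡j
    ; part-zero      = λ α → mk⇔ (λ e → label-o (part-of-o (label α) e))
                                  (λ { refl → trans (cong g label-zero) o-in-zero })
    ; part-transpose = λ i → gᵀ i , λ β → mk⇔ (to i β) (from i β)
    }
    where
    open Admissible G
    label-tr : ∀ α → g (label (tr α)) ≡ gᵀ (g (label α))
    label-tr α = trans (cong g (label-t α)) (transpose-parts (label α))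
    gᵀ-involutive : ∀ i → gᵀ (gᵀ i) ≡ i
    gᵀ-involutive i =
      let (w , gw≡i) = part-nonempty i
      in trans (cong (gᵀ ∘ gᵀ) (sym gw≡i))
               (trans (sym (trans (transpose-parts (w ᵀ)) (cong gᵀ (transpose-parts w))))
                      (trans (cong g (ᵀ-involutive w)) gw≡i))
    to : ∀ i β → g (label β) ≡ gᵀ i → ∃ λ α → g (label α) ≡ i × β ≡ tr α
    to i β e = tr β , trans (label-tr β) (trans (cong gᵀ e) (gᵀ-involutive i)) , sym (tr-involutive β)
    from : ∀ i β → (∃ λ α → g (label α) ≡ i × β ≡ tr α) → g (label β) ≡ gᵀ i
    from i β (α , e , refl) = trans (label-tr α) (cong gᵀ e)

  skew-amorphous : SkewAmorphous c
  skew-amorphous = record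
    { diagonal   = λ x y e → Equivalence.to (diagonal x y) (label-o e)
    ; reflexive  = λ x → trans (cong label (Equivalence.from (diagonal x x) refl)) label-zero
    ; transposed = λ x y → trans (cong label (tr-flip y x)) (label-t (r x y))
    ; occurs     = λ w → let (x , y , e) = nonempty (index w) in x , y , trans (cong label e) (label-index w)
    ; fusion     = λ g G → amorphous _ (g ∘ label) (admissible-indices G)
    }

theorem1p1 : ∀ (n : ℕ) → 2 ≤ n → (r : Fin n → Fin n → Fin 5) →
    (S : IsAssocScheme r) → SkewSymmetric r → ¬ Amorphous S
theorem1p1 zero    ()
theorem1p1 (suc m) _ r S skew amorphous =
  no-skew-amorphous (FromScheme.skew-amorphous S (labelling-of S skew) amorphous)
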